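{- Let $v\geq 2$. The graph $\Gamma(2,v)$ defined below is, up to isomorphism, the unique maximal strongly $(2,v)$-clique-partitioned graph; moreover $\Gamma(2,v)$ is isomorphic to the complete graph $K_{2v}$ with the edges of a Hamiltonian cycle removed.
   Context: A $v$-clique is a set of $v$ pairwise adjacent vertices. A graph of order $nv$ is weakly $(n,v)$-clique-partitioned if its vertex set can be decomposed in a unique way into $n$ vertex-disjoint $v$-cliques; it is strongly $(n,v)$-clique-partitioned if moreover the only $v$-cliques in it are the $n$ cliques of that decomposition. Every strongly $(n,v)$-clique-partitioned graph has at most $\frac{n}{2}v(v-1)+\frac{nv(n-1)(v-2)}{2}$ edges; one is called maximal if it has exactly this many edges. The graph $\Gamma(n,v)$ has vertex set $\{(i,j):0\leq i\leq n-1,\ 0\leq j\leq v-1\}$, and $(i,j)$ is adjacent to $(k,\ell)$ if and only if one of: (1) $i=k$ and $j\neq \ell$; (2) $i<k$ and $\ell-j\not\equiv 0,1 \pmod v$; (3) $i>k$ and $j-\ell\not\equiv 0,1\pmod v$. -}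

module Defs where

open import Level using (0ℓ)
open import Data.Nat as ℕ using (ℕ; _*_; _+_; _∸_; suc; zero)
import Data.Nat.Properties as ℕP
import Data.Nat.Divisibility as ℕD
open import Data.Integer as ℤ using (ℤ; +_)
open import Data.Integer.Divisibility as ℤD using ()
open import Data.Fin as F using (Fin; toℕ; remQuot)
import Data.Fin.Properties as FP
open import Data.Fin.Subset using (Subset; _∈_; ∣_∣)
open import Data.Vec using (tabulate)
open import Data.Bool using (Bool; true; false)
open import Data.List using (List; map; allFin)
open import Data.Nat.ListAction using (sum)
open import Data.Product using (Σ; ∃; _×_; _,_; proj₁; proj₂)
open import Data.Sum using (_⊎_; inj₁; inj₂)
open import Data.Empty using (⊥-elim)
open import Relation.Nullary using (¬_; Dec; yes; no)
open import Relation.Nullary.Decidable using (⌊_⌋; _×-dec_; _⊎-dec_; ¬?)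
open import Relation.Binary using (Decidable; Symmetric)
open import Relation.Binary.PropositionalEquality using (_≡_; _≢_; refl; sym)
open import Function.Bundles using (_↔_; _⇔_; Inverse)

record Graph (N : ℕ) : Set₁ where
  field
    Adj    : Fin N → Fin N → Set
    adj?   : Decidable Adj
    adj-sym : Symmetric Adj
    adj-irrefl : ∀ x → ¬ Adj x x

open Graph public

numEdges : ∀ {N} → Graph N → ℕ
numEdges {N} G = sum (map (λ x → sum (map (λ y → edge x y) (allFin N))) (allFin N))
  where
  edge : Fin N → Fin N → ℕ
  edge x y with toℕ x ℕ.<? toℕ y | adj? G x y
  ... | yes _ | yes _ = 1
  ... | _     | _     = 0

_≅_ : ∀ {N M} → Graph N → Graph M → Set
_≅_ {N} {M} G H =
  Σ (Fin N ↔ Fin M) λ f → ∀ x y → Adj G x y ⇔ Adj H (Inverse.to f x) (Inverse.to f y)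

IsClique : ∀ {N} → Graph N → ℕ → Subset N → Set
IsClique G v S = (∣ S ∣ ≡ v) × (∀ x y → x ∈ S → y ∈ S → x ≢ y → Adj G x y)

block : ∀ {N n} → (Fin N → Fin n) → Fin n → Subset N
block c i = tabulate (λ x → ⌊ c x F.≟ i ⌋)

-- weakly (n,v)-clique-partitioned: order n*v, and the decomposition exists
-- and is unique (any two decompositions induce the same partition)
WeaklyCP : (n v : ℕ) → Graph (n * v) → Set
WeaklyCP n v G =
  Σ (Fin (n * v) → Fin n) λ c →
    (∀ i → IsClique G v (block c i)) ×
    (∀ (c' : Fin (n * v) → Fin n) → (∀ i → IsClique G v (block c' i)) →
       ∀ x y → (c x ≡ c y) ⇔ (c' x ≡ c' y))

StronglyCP : (n v : ℕ) → Graph (n * v) → Set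
StronglyCP n v G =
  Σ (Fin (n * v) → Fin n) λ c →
    (∀ i → IsClique G v (block c i)) ×
    (∀ (c' : Fin (n * v) → Fin n) → (∀ i → IsClique G v (block c' i)) →
       ∀ x y → (c x ≡ c y) ⇔ (c' x ≡ c' y)) ×
    (∀ S → IsClique G v S → ∃ λ i → S ≡ block c i)

-- maximal: strongly partitioned with exactly n/2 v(v-1) + nv(n-1)(v-2)/2 edges
-- (stated after multiplying by 2)
MaximalSCP : (n v : ℕ) → Graph (n * v) → Set
MaximalSCP n v G =
  StronglyCP n v G ×
  (2 * numEdges G ≡ n * v * (v ∸ 1) + n * v * (n ∸ 1) * (v ∸ 2))

-- the graph Γ(n,v); vertex (i,j) is encoded as F.combine i j, i.e. remQuot v

-- (a - b) mod v ∉ {0,1}, computed in ℤ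
Not01 : (v : ℕ) → Fin v → Fin v → Set
Not01 v a b =
  ¬ (+ v ℤD.∣ (+ toℕ a ℤ.- + toℕ b)) × ¬ (+ v ℤD.∣ (+ toℕ a ℤ.- + toℕ b ℤ.- ℤ.1ℤ))

dec∣ : ∀ v z → Dec (+ v ℤD.∣ z)
dec∣ v z = ℤ.∣ + v ∣ ℕD.∣? ℤ.∣ z ∣

not01? : ∀ v a b → Dec (Not01 v a b)
not01? v a b =
  ¬? (dec∣ v (+ toℕ a ℤ.- + toℕ b)) ×-dec ¬? (dec∣ v (+ toℕ a ℤ.- + toℕ b ℤ.- ℤ.1ℤ))

ΓAdj' : ∀ {n v} → Fin n × Fin v → Fin n × Fin v → Set
ΓAdj' {n} {v} (i , j) (k , l) =
  (i ≡ k × j ≢ l) ⊎ (i F.< k × Not01 v l j) ⊎ (k F.< i × Not01 v j l)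

ΓAdj'? : ∀ {n v} p q → Dec (ΓAdj' {n} {v} p q)
ΓAdj'? {n} {v} (i , j) (k , l) =
  ((i F.≟ k) ×-dec ¬? (j F.≟ l)) ⊎-dec
  ((i F.<? k) ×-dec not01? v l j) ⊎-dec ((k F.<? i) ×-dec not01? v j l)

ΓAdj'-sym : ∀ {n v} p q → ΓAdj' {n} {v} p q → ΓAdj' q p
ΓAdj'-sym _ _ (inj₁ (e , d)) = inj₁ (sym e , λ e' → d (sym e'))
ΓAdj'-sym _ _ (inj₂ (inj₁ a)) = inj₂ (inj₂ a)
ΓAdj'-sym _ _ (inj₂ (inj₂ a)) = inj₂ (inj₁ a)

ΓAdj'-irr : ∀ {n v} p → ¬ ΓAdj' {n} {v} p p
ΓAdj'-irr _ (inj₁ (_ , d)) = d refl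
ΓAdj'-irr (i , _) (inj₂ (inj₁ (lt , _))) = FP.<-irrefl refl lt
ΓAdj'-irr (i , _) (inj₂ (inj₂ (lt , _))) = FP.<-irrefl refl lt

Γ : (n v : ℕ) → Graph (n * v)
Γ n v = record
  { Adj    = λ x y → ΓAdj' {n} {v} (remQuot {n} v x) (remQuot {n} v y)
  ; adj?   = λ x y → ΓAdj'? {n} {v} (remQuot {n} v x) (remQuot {n} v y)
  ; adj-sym = λ {x} {y} → ΓAdj'-sym {n} {v} (remQuot {n} v x) (remQuot {n} v y)
  ; adj-irrefl = λ x → ΓAdj'-irr {n} {v} (remQuot {n} v x)
  }

-- complete graph K_N minus the edges of a Hamiltonian cycle.
-- The Hamiltonian cycle is given by a cyclic ordering σ : Fin N ↔ Fin N
-- (the cycle visits σ 0, σ 1, …, σ (N-1), σ 0).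

Follows : ∀ {N} → (Fin N ↔ Fin N) → Fin N → Fin N → Set
Follows {N} σ x y =
  (toℕ (Inverse.from σ y) ≡ suc (toℕ (Inverse.from σ x))) ⊎
  (suc (toℕ (Inverse.from σ x)) ≡ N × toℕ (Inverse.from σ y) ≡ 0)

Follows? : ∀ {N} σ x y → Dec (Follows {N} σ x y)
Follows? {N} σ x y =
  (toℕ (Inverse.from σ y) ℕ.≟ suc (toℕ (Inverse.from σ x))) ⊎-dec
  ((suc (toℕ (Inverse.from σ x)) ℕ.≟ N) ×-dec (toℕ (Inverse.from σ y) ℕ.≟ 0))

KminusHam : (N : ℕ) → (Fin N ↔ Fin N) → Graph N
KminusHam N σ = record
  { Adj    = λ x y → x ≢ y × ¬ Follows σ x y × ¬ Follows σ y x
  ; adj?   = λ x y → ¬? (x F.≟ y) ×-dec ¬? (Follows? σ x y) ×-dec ¬? (Follows? σ y x)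
  ; adj-sym = λ { (d , a , b) → (λ e → d (sym e)) , b , a }
  ; adj-irrefl = λ x (d , _) → d refl
  }

-- Let the two cliques of the partition be the blocks. Inside a block all edges are present, so the
-- edges of G are determined by its complement H, whose edges all join the two blocks. If a vertex x had
-- at most one H-neighbour b, then x together with the other block minus b would be a v-clique that is
-- not a block; hence strongness gives every vertex H-degree at least 2, and the maximal edge count then
-- forces H to be 2-regular. Walking along H from a vertex traces a cycle C. Double counting H-edges
-- shows that C meets both blocks equally often, so the vertices of C in the first block together with
-- the vertices of the second block off C form a v-clique; strongness makes it a block, which is only
-- possible if C passes through every vertex. So G is K_{2v} minus a Hamiltonian cycle, and all such
-- graphs are isomorphic. For Γ(2,v) the blocks are the rows, H joins (0,j) to (1,j) and (1,j+1), and a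
-- v-clique meeting row 0 in (0,j) must also contain (0,j+1), so the rows are its only v-cliques.

module Submission where

open import Defs
open import Data.Bool using (Bool; true; false; _∧_; _∨_; not)
import Data.Bool.Properties as BP
open import Data.Empty using (⊥; ⊥-elim)
open import Data.Fin as F using (Fin; toℕ)
import Data.Fin.Induction as FI
open import Data.Fin.Patterns using (0F; 1F)
import Data.Fin.Properties as FP
open import Data.Fin.Subset using (_∈_; ∣_∣)
import Data.Integer as ℤ
import Data.Integer.Divisibility as ℤD
import Data.Integer.Properties as ℤP
import Data.List as List hiding (sum)
import Data.List.Properties as ListP
open import Data.Nat as ℕ using (ℕ; zero; suc; _+_; _*_; _∸_; _≤_; _<_; z≤n; s≤s; ∣_-_∣)
import Data.Nat.Divisibility as ℕD
import Data.Nat.ListAction as List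
import Data.Nat.Properties as ℕP
open import Data.Nat.Tactic.RingSolver using (solve-∀)
open import Data.Product using (∃; _×_; _,_; proj₁; proj₂)
open import Data.Sum using (_⊎_; inj₁; inj₂)
open import Data.Vec using (tabulate; lookup)
import Data.Vec.Properties as VP
open import Function.Base using (_∘_; id)
open import Function.Bundles using (_↔_; _⇔_; Inverse; Equivalence; mk↔ₛ′; mk⇔)
open import Function.Construct.Composition using (_⇔-∘_)
open import Function.Construct.Identity using (⇔-id)
open import Function.Construct.Symmetry using (⇔-sym)
open import Function.Properties.Inverse using (↔-refl; ↔-sym; ↔-trans)
open import Relation.Binary using (tri<; tri≈; tri>)
open import Relation.Binary.PropositionalEquality
open import Relation.Nullary using (¬_; Dec; yes; no)
open import Relation.Nullary.Decidable using (⌊_⌋; ⌊⌋-map′; ¬?; _×-dec_)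
open import Algebra.Properties.Semiring.Sum ℕP.+-*-semiring
  using (sum-syntax; ∑-distrib-+; ∑-comm; sum-cong-≗; *-distribʳ-sum)

-- Finite sums and counting

∑-const : ∀ n k → ∑[ i < n ] k ≡ n * k
∑-const zero    k = refl
∑-const (suc n) k = cong (k +_) (∑-const n k)

∑-↑ : ∀ a {b} (f : Fin (a + b) → ℕ) →
      ∑[ x < a + b ] f x ≡ ∑[ i < a ] f (i F.↑ˡ b) + ∑[ j < b ] f (a F.↑ʳ j)
∑-↑ zero    f = refl
∑-↑ (suc a) f = trans (cong (f 0F +_) (∑-↑ a (f ∘ F.suc))) (sym (ℕP.+-assoc (f 0F) _ _))

∑-combine : ∀ m {n} (f : Fin (m * n) → ℕ) →
            ∑[ x < m * n ] f x ≡ ∑[ i < m ] ∑[ j < n ] f (F.combine i j)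
∑-combine zero        f = refl
∑-combine (suc m) {n} f =
  trans (∑-↑ n f) (cong (∑[ j < n ] f (F.combine {suc m} 0F j) +_) (∑-combine m (f ∘ (n F.↑ʳ_))))

∑-mono-≤ : ∀ {n} {f g : Fin n → ℕ} → (∀ i → f i ≤ g i) → ∑[ i < n ] f i ≤ ∑[ i < n ] g i
∑-mono-≤ {zero}  _   = z≤n
∑-mono-≤ {suc n} f≤g = ℕP.+-mono-≤ (f≤g 0F) (∑-mono-≤ (f≤g ∘ F.suc))

∑-tight : ∀ {n} {f g : Fin n → ℕ} → (∀ i → f i ≤ g i) →
          ∑[ i < n ] g i ≤ ∑[ i < n ] f i → ∀ i → g i ≤ f i
∑-tight {suc n} {f} {g} f≤g ∑g≤∑f = λ { 0F → head ; (F.suc i) → ∑-tight (f≤g ∘ F.suc) tail i }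
  where
  open ℕP.≤-Reasoning
  f₀ = f 0F
  g₀ = g 0F
  ∑f = ∑[ i < n ] f (F.suc i)
  ∑g = ∑[ i < n ] g (F.suc i)
  head : g₀ ≤ f₀
  head = ℕP.+-cancelʳ-≤ ∑f g₀ f₀ (begin
    g₀ + ∑f ≤⟨ ℕP.+-monoʳ-≤ g₀ (∑-mono-≤ (f≤g ∘ F.suc)) ⟩
    g₀ + ∑g ≤⟨ ∑g≤∑f ⟩
    f₀ + ∑f ∎)
  tail : ∑g ≤ ∑f
  tail = ℕP.+-cancelˡ-≤ f₀ ∑g ∑f (begin
    f₀ + ∑g ≤⟨ ℕP.+-monoˡ-≤ ∑g (f≤g 0F) ⟩
    g₀ + ∑g ≤⟨ ∑g≤∑f ⟩
    f₀ + ∑f ∎)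

sum-map-allFin : ∀ {n} (f : Fin n → ℕ) → List.sum (List.map f (List.allFin n)) ≡ ∑[ x < n ] f x
sum-map-allFin {n} f = trans (cong List.sum (ListP.map-tabulate {n = n} id f)) (sum-tabulate f)
  where
  sum-tabulate : ∀ {n} (f : Fin n → ℕ) → List.sum (List.tabulate f) ≡ ∑[ x < n ] f x
  sum-tabulate {zero}  f = refl
  sum-tabulate {suc n} f = cong (f 0F +_) (sum-tabulate (f ∘ F.suc))

_≡ᵇ_ : ∀ {n} → Fin n → Fin n → Bool
x ≡ᵇ y = ⌊ x F.≟ y ⌋

≡ᵇ-refl : ∀ {n} (x : Fin n) → (x ≡ᵇ x) ≡ true
≡ᵇ-refl x with x F.≟ x
... | yes _  = refl
... | no x≢x = ⊥-elim (x≢x refl)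

≡⇒≡ᵇ : ∀ {n} {x y : Fin n} → x ≡ y → (x ≡ᵇ y) ≡ true
≡⇒≡ᵇ refl = ≡ᵇ-refl _

≡ᵇ⇒≡ : ∀ {n} {x y : Fin n} → (x ≡ᵇ y) ≡ true → x ≡ y
≡ᵇ⇒≡ {x = x} {y} e with x F.≟ y
... | yes x≡y = x≡y

≢⇒≡ᵇ-false : ∀ {n} {x y : Fin n} → x ≢ y → (x ≡ᵇ y) ≡ false
≢⇒≡ᵇ-false {x = x} {y} x≢y with x F.≟ y
... | yes x≡y = ⊥-elim (x≢y x≡y)
... | no _    = refl

≡ᵇ-false⇒≢ : ∀ {n} {x y : Fin n} → (x ≡ᵇ y) ≡ false → x ≢ y
≡ᵇ-false⇒≢ e refl with trans (sym (≡ᵇ-refl _)) e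
... | ()

≡ᵇ-sym : ∀ {n} (x y : Fin n) → (x ≡ᵇ y) ≡ (y ≡ᵇ x)
≡ᵇ-sym x y with x F.≟ y | y F.≟ x
... | yes _   | yes _   = refl
... | no _    | no _    = refl
... | yes x≡y | no y≢x  = ⊥-elim (y≢x (sym x≡y))
... | no x≢y  | yes y≡x = ⊥-elim (x≢y (sym y≡x))

¬[≢×≢]⇒≡⊎≡ : ∀ {n} {x y z : Fin n} → ¬ (x ≢ y × x ≢ z) → x ≡ y ⊎ x ≡ z
¬[≢×≢]⇒≡⊎≡ {x = x} {y} {z} ¬both with x F.≟ y | x F.≟ z
... | yes x≡y | _       = inj₁ x≡y
... | no _    | yes x≡z = inj₂ x≡z
... | no x≢y  | no x≢z  = ⊥-elim (¬both (x≢y , x≢z))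

∧-true⁻ : ∀ {a b} → a ∧ b ≡ true → a ≡ true × b ≡ true
∧-true⁻ {true} {true} _ = refl , refl

∨-true⁻ : ∀ {a b} → a ∨ b ≡ true → a ≡ true ⊎ b ≡ true
∨-true⁻ {true}  _ = inj₁ refl
∨-true⁻ {false} e = inj₂ e

not-true⁻ : ∀ {a} → not a ≡ true → a ≡ false
not-true⁻ {false} _ = refl

not-false⁺ : ∀ {a} → a ≡ false → not a ≡ true
not-false⁺ refl = refl

true≢false : ∀ {a} → a ≡ true → a ≢ false
true≢false refl ()

_⊆ᵇ_ : ∀ {n} → (Fin n → Bool) → (Fin n → Bool) → Set
p ⊆ᵇ q = ∀ x → p x ≡ true → q x ≡ true

indicator : Bool → ℕ
indicator true  = 1
indicator false = 0

indicator-mono : ∀ {a b} → (a ≡ true → b ≡ true) → indicator a ≤ indicator b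
indicator-mono {false}         _   = z≤n
indicator-mono {true}  {true}  _   = ℕP.≤-refl
indicator-mono {true}  {false} a⇒b with a⇒b refl
... | ()

indicator-reflect : ∀ {a b} → indicator b ≤ indicator a → b ≡ true → a ≡ true
indicator-reflect {true}         _ _ = refl
indicator-reflect {false} {true} () _

count : ∀ {n} → (Fin n → Bool) → ℕ
count {n} p = ∑[ x < n ] indicator (p x)

count-cong : ∀ {n} {p q : Fin n → Bool} → (∀ x → p x ≡ q x) → count p ≡ count q
count-cong p≗q = sum-cong-≗ (cong indicator ∘ p≗q)

count-split : ∀ {n} (p q : Fin n → Bool) →
              count p ≡ count (λ x → p x ∧ q x) + count (λ x → p x ∧ not (q x))
count-split p q = trans (sum-cong-≗ (λ x → pointwise (p x) (q x)))
  (∑-distrib-+ (λ x → indicator (p x ∧ q x)) (λ x → indicator (p x ∧ not (q x))))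
  where
  pointwise : ∀ a b → indicator a ≡ indicator (a ∧ b) + indicator (a ∧ not b)
  pointwise true  true  = refl
  pointwise true  false = refl
  pointwise false _     = refl

count-true : ∀ {n} → count {n} (λ _ → true) ≡ n
count-true {n} = trans (∑-const n 1) (ℕP.*-identityʳ n)

count-false : ∀ {n} → count {n} (λ _ → false) ≡ 0
count-false {n} = trans (∑-const n 0) (ℕP.*-zeroʳ n)

count-+-count-not : ∀ {n} (p : Fin n → Bool) → count p + count (not ∘ p) ≡ n
count-+-count-not p = trans (sym (count-split (λ _ → true) p)) count-true

count-mono : ∀ {n} {p q : Fin n → Bool} → p ⊆ᵇ q → count p ≤ count q
count-mono p⊆q = ∑-mono-≤ (λ x → indicator-mono (p⊆q x))

count-⊆-antisym : ∀ {n} {p q : Fin n → Bool} → p ⊆ᵇ q → count q ≤ count p → q ⊆ᵇ p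
count-⊆-antisym p⊆q q≤p x = indicator-reflect (∑-tight (λ y → indicator-mono (p⊆q y)) q≤p x)

count≡0⇒false : ∀ {n} (p : Fin n → Bool) → count p ≡ 0 → ∀ x → p x ≡ false
count≡0⇒false {n} p c x with p x in px
... | false = refl
... | true  with count-⊆-antisym {p = λ _ → false} {q = p} (λ _ ())
                   (ℕP.≤-reflexive (trans c (sym (count-false {n})))) x px
...   | ()

count>0⇒∃ : ∀ {n} (p : Fin n → Bool) → 0 < count p → ∃ λ x → p x ≡ true
count>0⇒∃ {suc n} p c with p 0F in p₀
... | true  = 0F , p₀
... | false with count>0⇒∃ (p ∘ F.suc) c
...   | x , px = F.suc x , px

count-singleton : ∀ {n} (y : Fin n) → count (_≡ᵇ y) ≡ 1
count-singleton {suc n} 0F =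
  cong suc (trans (count-cong {n} {λ x → F.suc x ≡ᵇ 0F} (λ x → ≢⇒≡ᵇ-false {x = F.suc x} {0F} λ ()))
                  (count-false {n}))
count-singleton {suc n} (F.suc y) = trans (count-cong suc≡ᵇsuc) (count-singleton y)
  where
  suc≡ᵇsuc : ∀ x → (F.suc x ≡ᵇ F.suc y) ≡ (x ≡ᵇ y)
  suc≡ᵇsuc x = ⌊⌋-map′ (cong F.suc) FP.suc-injective (x F.≟ y)

count-∨ : ∀ {n} (p q : Fin n → Bool) → (∀ x → p x ∧ q x ≡ false) →
          count (λ x → p x ∨ q x) ≡ count p + count q
count-∨ p q disjoint = trans (count-split _ p) (cong₂ _+_ (count-cong left) (count-cong right))
  where
  left : ∀ x → (p x ∨ q x) ∧ p x ≡ p x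
  left x with p x
  ... | true  = refl
  ... | false = BP.∧-zeroʳ (q x)
  right : ∀ x → (p x ∨ q x) ∧ not (p x) ≡ q x
  right x with p x | q x | disjoint x
  ... | true  | false | _  = refl
  ... | false | _     | _  = BP.∧-identityʳ _

count-pair : ∀ {n} {y z : Fin n} → y ≢ z → count (λ x → x ≡ᵇ y ∨ x ≡ᵇ z) ≡ 2
count-pair {y = y} {z} y≢z =
  trans (count-∨ (_≡ᵇ y) (_≡ᵇ z) disjoint) (cong₂ _+_ (count-singleton y) (count-singleton z))
  where
  disjoint : ∀ x → (x ≡ᵇ y) ∧ (x ≡ᵇ z) ≡ false
  disjoint x with x F.≟ y
  ... | no _     = refl
  ... | yes refl = ≢⇒≡ᵇ-false y≢z

pair-⊆ : ∀ {n} {p : Fin n → Bool} {y z} → p y ≡ true → p z ≡ true →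
         (λ x → x ≡ᵇ y ∨ x ≡ᵇ z) ⊆ᵇ p
pair-⊆ {p = p} py pz x x∈yz with ∨-true⁻ x∈yz
... | inj₁ x≡y = subst (λ t → p t ≡ true) (sym (≡ᵇ⇒≡ x≡y)) py
... | inj₂ x≡z = subst (λ t → p t ≡ true) (sym (≡ᵇ⇒≡ x≡z)) pz

count≤1⇒unique : ∀ {n} (p : Fin n → Bool) {y z} → count p ≤ 1 → p y ≡ true → p z ≡ true → y ≡ z
count≤1⇒unique p {y} {z} c py pz with y F.≟ z
... | yes y≡z = y≡z
... | no y≢z  = ⊥-elim (ℕP.<-irrefl refl (begin
  2                                  ≡⟨ count-pair y≢z ⟨
  count (λ x → x ≡ᵇ y ∨ x ≡ᵇ z)      ≤⟨ count-mono (pair-⊆ {p = p} py pz) ⟩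
  count p                            ≤⟨ c ⟩
  1                                  ∎))
  where open ℕP.≤-Reasoning

count≡2⇒pair : ∀ {n} (p : Fin n → Bool) {y z} → count p ≡ 2 → y ≢ z → p y ≡ true → p z ≡ true →
               ∀ x → p x ≡ true → x ≡ y ⊎ x ≡ z
count≡2⇒pair p c y≢z py pz x px with ∨-true⁻ (count-⊆-antisym (pair-⊆ py pz)
                                            (ℕP.≤-reflexive (trans c (sym (count-pair y≢z)))) x px)
... | inj₁ x≡y = inj₁ (≡ᵇ⇒≡ x≡y)
... | inj₂ x≡z = inj₂ (≡ᵇ⇒≡ x≡z)

count-remove : ∀ {n} (p : Fin n → Bool) {b} → p b ≡ true →
               count (λ y → p y ∧ not (y ≡ᵇ b)) + 1 ≡ count p
count-remove p {b} pb =
  trans (ℕP.+-comm _ 1) (sym (trans (count-split p (_≡ᵇ b)) (cong (_+ count (λ y → p y ∧ not (y ≡ᵇ b)))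
                                                                  (trans (count-cong onlyB) (count-singleton b)))))
  where
  onlyB : ∀ y → p y ∧ y ≡ᵇ b ≡ y ≡ᵇ b
  onlyB y with y F.≟ b
  ... | yes refl = cong (_∧ true) pb
  ... | no _     = BP.∧-zeroʳ (p y)

count-insert : ∀ {n} (p : Fin n → Bool) {x} → p x ≡ false → count (λ y → y ≡ᵇ x ∨ p y) ≡ suc (count p)
count-insert p {x} px = trans (count-∨ (_≡ᵇ x) p disjoint) (cong (_+ count p) (count-singleton x))
  where
  disjoint : ∀ y → y ≡ᵇ x ∧ p y ≡ false
  disjoint y with y F.≟ x
  ... | yes refl = px
  ... | no _     = refl

∣tabulate∣≡count : ∀ {n} (p : Fin n → Bool) → ∣ tabulate p ∣ ≡ count p
∣tabulate∣≡count {zero}  p = refl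
∣tabulate∣≡count {suc n} p with p 0F
... | true  = cong suc (∣tabulate∣≡count (p ∘ F.suc))
... | false = ∣tabulate∣≡count (p ∘ F.suc)

∈tabulate⁻ : ∀ {n} (p : Fin n → Bool) {x} → x ∈ tabulate p → p x ≡ true
∈tabulate⁻ p {x} x∈p = trans (sym (VP.lookup∘tabulate p x)) (VP.[]=⇒lookup x∈p)

∈tabulate⁺ : ∀ {n} (p : Fin n → Bool) {x} → p x ≡ true → x ∈ tabulate p
∈tabulate⁺ p {x} px = VP.lookup⇒[]= x (tabulate p) (trans (VP.lookup∘tabulate p x) px)

image : ∀ {n} → ℕ → (ℕ → Fin n) → Fin n → Bool
image zero    w y = false
image (suc t) w y = image t w y ∨ y ≡ᵇ w t

image⁻ : ∀ {n} t (w : ℕ → Fin n) {y} → image t w y ≡ true → ∃ λ k → k < t × y ≡ w k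
image⁻ (suc t) w {y} y∈ with ∨-true⁻ {image t w y} y∈
... | inj₁ y∈′ = let k , k<t , y≡wk = image⁻ t w y∈′ in k , ℕP.m<n⇒m<1+n k<t , y≡wk
... | inj₂ y≡wt = t , ℕP.n<1+n t , ≡ᵇ⇒≡ y≡wt

image⁺ : ∀ {n} t (w : ℕ → Fin n) {k} → k < t → image t w (w k) ≡ true
image⁺ (suc t) w {k} k<1+t with ℕP.m≤n⇒m<n∨m≡n k<1+t
... | inj₂ refl = trans (cong (image t w (w t) ∨_) (≡ᵇ-refl (w t))) (BP.∨-zeroʳ _)
... | inj₁ k<1+t′ = cong (_∨ (w k ≡ᵇ w t)) (image⁺ t w (ℕP.≤-pred k<1+t′))

count-image : ∀ {n} t (w : ℕ → Fin n) → (∀ {a b} → a < t → b < t → w a ≡ w b → a ≡ b) →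
              count (image t w) ≡ t
count-image {n} zero    w _   = count-false {n}
count-image     (suc t) w inj =
  trans (count-∨ (image t w) (_≡ᵇ w t) disjoint)
        (trans (cong₂ _+_ (count-image t w (λ a<t b<t → inj (ℕP.m<n⇒m<1+n a<t) (ℕP.m<n⇒m<1+n b<t)))
                          (count-singleton (w t)))
               (ℕP.+-comm t 1))
  where
  disjoint : ∀ y → image t w y ∧ (y ≡ᵇ w t) ≡ false
  disjoint y with image t w y in y∈ | y F.≟ w t
  ... | false | _        = refl
  ... | true  | no _     = refl
  ... | true  | yes refl with image⁻ t w y∈
  ...   | k , k<t , wt≡wk = ⊥-elim (ℕP.<-irrefl (inj (ℕP.m<n⇒m<1+n k<t) (ℕP.n<1+n t) (sym wt≡wk)) k<t)

least : ∀ {Q : ℕ → Set} → (∀ j → Dec (Q j)) → ∀ {n} → Q n →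
        ∃ λ m → Q m × (∀ {j} → j < m → ¬ Q j)
least Q? q with Q? 0
... | yes q₀ = 0 , q₀ , λ ()
least Q? {zero}  q | no ¬q₀ = ⊥-elim (¬q₀ q)
least Q? {suc n} q | no ¬q₀ with least (Q? ∘ suc) q
... | m , qm , below = suc m , qm , λ { {zero} _ → ¬q₀ ; {suc j} j<m → below (ℕP.≤-pred j<m) }

-- Graphs, degrees and complements

adjᵇ : ∀ {n} (G : Graph n) → Fin n → Fin n → Bool
adjᵇ G x y = ⌊ adj? G x y ⌋

adjᵇ-true⁻ : ∀ {n} (G : Graph n) {x y} → adjᵇ G x y ≡ true → Adj G x y
adjᵇ-true⁻ G {x} {y} e with adj? G x y
... | yes a = a

adjᵇ-true⁺ : ∀ {n} (G : Graph n) {x y} → Adj G x y → adjᵇ G x y ≡ true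
adjᵇ-true⁺ G {x} {y} a with adj? G x y
... | yes _  = refl
... | no ¬a = ⊥-elim (¬a a)

adjᵇ-false⁺ : ∀ {n} (G : Graph n) {x y} → ¬ Adj G x y → adjᵇ G x y ≡ false
adjᵇ-false⁺ G {x} {y} ¬a with adj? G x y
... | yes a = ⊥-elim (¬a a)
... | no _  = refl

adjᵇ-sym : ∀ {n} (G : Graph n) x y → adjᵇ G x y ≡ adjᵇ G y x
adjᵇ-sym G x y with adj? G x y | adj? G y x
... | yes _  | yes _  = refl
... | no _   | no _   = refl
... | yes a  | no ¬a  = ⊥-elim (¬a (adj-sym G a))
... | no ¬a  | yes a  = ⊥-elim (¬a (adj-sym G a))

degree : ∀ {n} → Graph n → Fin n → ℕ
degree G x = count (adjᵇ G x)

orderedEdge : ∀ {n} → Graph n → Fin n → Fin n → ℕ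
orderedEdge G x y = indicator (⌊ toℕ x ℕ.<? toℕ y ⌋ ∧ adjᵇ G x y)

numEdges≡∑orderedEdge : ∀ {n} (G : Graph n) → numEdges G ≡ ∑[ x < n ] ∑[ y < n ] orderedEdge G x y
numEdges≡∑orderedEdge {n} G =
  trans numEdges≡sum (trans (sum-map-allFin (λ x → List.sum (List.map (orderedEdge G x) (List.allFin n))))
    (sum-cong-≗ (λ x → sum-map-allFin (orderedEdge G x))))
  where
  -- The left-hand side is the unnamed local edge function of numEdges; it is solved from the use in
  -- numEdges≡sum, which therefore has to be checked before the clauses of pointwise.
  pointwise : ∀ x y → _ ≡ orderedEdge G x y
  numEdges≡sum : numEdges G ≡ List.sum (List.map (λ x → List.sum (List.map (orderedEdge G x) (List.allFin n)))
                                                  (List.allFin n))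
  numEdges≡sum = cong List.sum (ListP.map-cong (λ x → cong List.sum (ListP.map-cong (pointwise x) (List.allFin n)))
                                               (List.allFin n))
  pointwise x y with toℕ x ℕ.<? toℕ y | adj? G x y
  ... | yes _ | yes _ = refl
  ... | yes _ | no _  = refl
  ... | no _  | _     = refl

orderedEdge-+-flip : ∀ {n} (G : Graph n) x y → orderedEdge G x y + orderedEdge G y x ≡ indicator (adjᵇ G x y)
orderedEdge-+-flip G x y rewrite adjᵇ-sym G y x
  with toℕ x ℕ.<? toℕ y | toℕ y ℕ.<? toℕ x | adjᵇ G x y in xy
... | yes x<y | yes y<x | _     = ⊥-elim (ℕP.<-asym x<y y<x)
... | yes _   | no _    | true  = refl
... | yes _   | no _    | false = refl
... | no _    | yes _   | true  = refl
... | no _    | yes _   | false = refl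
... | no _    | no _    | false = refl
... | no x≮y  | no y≮x  | true  = ⊥-elim (adj-irrefl G x (subst (Adj G x) (sym x≡y) (adjᵇ-true⁻ G xy)))
  where
  x≡y : x ≡ y
  x≡y = FP.toℕ-injective (ℕP.≤-antisym (ℕP.≮⇒≥ y≮x) (ℕP.≮⇒≥ x≮y))

handshake : ∀ {n} (G : Graph n) → 2 * numEdges G ≡ ∑[ x < n ] degree G x
handshake {n} G = begin
  2 * numEdges G                     ≡⟨ cong (2 *_) (numEdges≡∑orderedEdge G) ⟩
  E + (E + 0)                        ≡⟨ cong (E +_) (trans (ℕP.+-identityʳ E) (∑-comm (orderedEdge G))) ⟩
  E + ∑[ x < n ] ∑[ y < n ] orderedEdge G y x
    ≡⟨ sym (∑-distrib-+ (λ x → ∑[ y < n ] orderedEdge G x y) _) ⟩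
  ∑[ x < n ] (∑[ y < n ] orderedEdge G x y + ∑[ y < n ] orderedEdge G y x)
    ≡⟨ sum-cong-≗ (λ x → sym (∑-distrib-+ (orderedEdge G x) (λ y → orderedEdge G y x))) ⟩
  ∑[ x < n ] ∑[ y < n ] (orderedEdge G x y + orderedEdge G y x)
    ≡⟨ sum-cong-≗ (λ x → sum-cong-≗ (orderedEdge-+-flip G x)) ⟩
  ∑[ x < n ] degree G x               ∎
  where
  open ≡-Reasoning
  E = ∑[ x < n ] ∑[ y < n ] orderedEdge G x y

complement : ∀ {n} → Graph n → Graph n
complement G = record
  { Adj        = λ x y → x ≢ y × ¬ Adj G x y
  ; adj?       = λ x y → ¬? (x F.≟ y) ×-dec ¬? (adj? G x y)
  ; adj-sym    = λ (x≢y , ¬xy) → x≢y ∘ sym , ¬xy ∘ adj-sym G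
  ; adj-irrefl = λ x (x≢x , _) → x≢x refl
  }

adjᵇ-complement : ∀ {n} (G : Graph n) x y → adjᵇ (complement G) x y ≡ not (x ≡ᵇ y) ∧ not (adjᵇ G x y)
adjᵇ-complement G x y with x F.≟ y | adj? G x y
... | yes _ | _     = refl
... | no _  | yes _ = refl
... | no _  | no _  = refl

degree-+-degree-complement : ∀ {n} (G : Graph n) x → degree G x + degree (complement G) x + 1 ≡ n
degree-+-degree-complement {n} G x = begin
  count (adjᵇ G x) + count (adjᵇ (complement G) x) + 1
    ≡⟨ ℕP.+-assoc (count (adjᵇ G x)) _ 1 ⟩
  count (adjᵇ G x) + (count (adjᵇ (complement G) x) + 1)
    ≡⟨ cong (count (adjᵇ G x) +_) (trans (ℕP.+-comm _ 1) (cong₂ _+_ (sym loop) (count-cong nonLoop))) ⟩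
  count (adjᵇ G x) + (count (λ y → not (adjᵇ G x y) ∧ y ≡ᵇ x)
                    + count (λ y → not (adjᵇ G x y) ∧ not (y ≡ᵇ x)))
    ≡⟨ cong (count (adjᵇ G x) +_) (sym (count-split (not ∘ adjᵇ G x) (_≡ᵇ x))) ⟩
  count (adjᵇ G x) + count (not ∘ adjᵇ G x)
    ≡⟨ count-+-count-not (adjᵇ G x) ⟩
  n ∎
  where
  open ≡-Reasoning
  loop : count (λ y → not (adjᵇ G x y) ∧ y ≡ᵇ x) ≡ 1
  loop = trans (count-cong onlyX) (count-singleton x)
    where
    onlyX : ∀ y → not (adjᵇ G x y) ∧ y ≡ᵇ x ≡ y ≡ᵇ x
    onlyX y with y F.≟ x
    ... | no _     = BP.∧-zeroʳ _
    ... | yes refl = cong (_∧ true) (cong not (adjᵇ-false⁺ G (adj-irrefl G y)))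
  nonLoop : ∀ y → adjᵇ (complement G) x y ≡ not (adjᵇ G x y) ∧ not (y ≡ᵇ x)
  nonLoop y = trans (adjᵇ-complement G x y)
                    (trans (BP.∧-comm (not (x ≡ᵇ y)) _)
                           (cong (λ b → not (adjᵇ G x y) ∧ not b) (≡ᵇ-sym x y)))

∑-degree-+-complement : ∀ {n} (G : Graph n) → 2 * numEdges G + ∑[ x < n ] degree (complement G) x + n ≡ n * n
∑-degree-+-complement {n} G = begin
  2 * numEdges G + ∑[ x < n ] degree (complement G) x + n
    ≡⟨ cong₂ (λ a b → a + ∑[ x < n ] degree (complement G) x + b)
             (handshake G) (trans (sym (ℕP.*-identityʳ n)) (sym (∑-const n 1))) ⟩
  ∑[ x < n ] degree G x + ∑[ x < n ] degree (complement G) x + ∑[ x < n ] 1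
    ≡⟨ cong (_+ ∑[ x < n ] 1) (∑-distrib-+ (degree G) (degree (complement G))) ⟨
  ∑[ x < n ] (degree G x + degree (complement G) x) + ∑[ x < n ] 1
    ≡⟨ ∑-distrib-+ (λ x → degree G x + degree (complement G) x) (λ _ → 1) ⟨
  ∑[ x < n ] (degree G x + degree (complement G) x + 1)
    ≡⟨ sum-cong-≗ (degree-+-degree-complement G) ⟩
  ∑[ x < n ] n
    ≡⟨ ∑-const n n ⟩
  n * n ∎
  where open ≡-Reasoning

∑≡2n⇒2-regular : ∀ {n} (d : Fin n → ℕ) → (∀ x → 2 ≤ d x) →
                 ∑[ x < n ] d x ≡ n * 2 → ∀ x → d x ≡ 2
∑≡2n⇒2-regular {n} d 2≤d ∑d≡2n x =
  ℕP.≤-antisym (∑-tight 2≤d (ℕP.≤-reflexive (trans ∑d≡2n (sym (∑-const n 2)))) x) (2≤d x)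

-- Both sides count the edges between A and B, once from each end.
regular-balanced : ∀ {n d} (H : Graph n) → (∀ x → degree H x ≡ suc d) → (A B : Fin n → Bool) →
                   (∀ {x y} → A x ≡ true → Adj H x y → B y ≡ true) →
                   (∀ {x y} → B x ≡ true → Adj H x y → A y ≡ true) → count A ≡ count B
regular-balanced {n} {d} H regular A B A→B B→A = ℕP.*-cancelʳ-≡ (count A) (count B) (suc d) (begin
  count A * suc d                                    ≡⟨ *-distribʳ-sum (suc d) (indicator ∘ A) ⟩
  ∑[ x < n ] (indicator (A x) * suc d)               ≡⟨ sum-cong-≗ edgesFrom ⟨
  ∑[ x < n ] ∑[ y < n ] indicator (A x ∧ adjᵇ H x y) ≡⟨ ∑-comm (λ x y → indicator (A x ∧ adjᵇ H x y)) ⟩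
  ∑[ y < n ] ∑[ x < n ] indicator (A x ∧ adjᵇ H x y) ≡⟨ sum-cong-≗ edgesInto ⟩
  ∑[ y < n ] (indicator (B y) * suc d)               ≡⟨ *-distribʳ-sum (suc d) (indicator ∘ B) ⟨
  count B * suc d                                    ∎)
  where
  open ≡-Reasoning
  edgesFrom : ∀ x → count (λ y → A x ∧ adjᵇ H x y) ≡ indicator (A x) * suc d
  edgesFrom x with A x
  ... | true  = trans (regular x) (sym (ℕP.+-identityʳ (suc d)))
  ... | false = count-false {n}
  edgesInto : ∀ y → count (λ x → A x ∧ adjᵇ H x y) ≡ indicator (B y) * suc d
  edgesInto y with B y in By
  ... | true  = trans (count-cong fromNeighbour) (trans (regular y) (sym (ℕP.+-identityʳ (suc d))))
    where
    fromNeighbour : ∀ x → A x ∧ adjᵇ H x y ≡ adjᵇ H y x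
    fromNeighbour x with adj? H y x
    ... | yes yx = trans (cong (_∧ adjᵇ H x y) (B→A By yx)) (adjᵇ-true⁺ H (adj-sym H yx))
    ... | no ¬yx = trans (cong (A x ∧_) (adjᵇ-false⁺ H (¬yx ∘ adj-sym H))) (BP.∧-zeroʳ (A x))
  ... | false = trans (count-cong noNeighbour) (count-false {n})
    where
    noNeighbour : ∀ x → A x ∧ adjᵇ H x y ≡ false
    noNeighbour x with A x in Ax | adj? H x y
    ... | false | _      = refl
    ... | true  | no _   = refl
    ... | true  | yes xy = ⊥-elim (true≢false (A→B Ax xy) By)

≅-trans : ∀ {N M L} {G : Graph N} {H : Graph M} {K : Graph L} → G ≅ H → H ≅ K → G ≅ K
≅-trans (f , f-adj) (g , g-adj) = ↔-trans f g , λ x y → g-adj _ _ ⇔-∘ f-adj x y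

≅-sym : ∀ {N M} {G : Graph N} {H : Graph M} → G ≅ H → H ≅ G
≅-sym {G = G} {H} (f , f-adj) = ↔-sym f , λ x y →
  ⇔-sym (subst₂ (λ x′ y′ → Adj G (Inverse.from f x) (Inverse.from f y) ⇔ Adj H x′ y′)
                (Inverse.strictlyInverseˡ f x) (Inverse.strictlyInverseˡ f y)
                (f-adj (Inverse.from f x) (Inverse.from f y)))

KminusHam-unique : ∀ N (σ τ : Fin N ↔ Fin N) → KminusHam N σ ≅ KminusHam N τ
KminusHam-unique N σ τ = h , λ x y → mk⇔ (preserve x y) (reflect x y)
  where
  h : Fin N ↔ Fin N
  h = ↔-trans (↔-sym σ) τ
  position-h : ∀ x → Inverse.from τ (Inverse.to h x) ≡ Inverse.from σ x
  position-h x = Inverse.strictlyInverseʳ τ (Inverse.from σ x)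
  follows-h : ∀ x y → Follows σ x y ⇔ Follows τ (Inverse.to h x) (Inverse.to h y)
  follows-h x y = subst₂ (λ a b → Follows σ x y ⇔ (toℕ b ≡ suc (toℕ a) ⊎ (suc (toℕ a) ≡ N × toℕ b ≡ 0)))
                         (sym (position-h x)) (sym (position-h y)) (⇔-id _)
  h-injective : ∀ {x y} → Inverse.to h x ≡ Inverse.to h y → x ≡ y
  h-injective {x} {y} e =
    trans (sym (Inverse.strictlyInverseʳ h x)) (trans (cong (Inverse.from h) e) (Inverse.strictlyInverseʳ h y))
  preserve : ∀ x y → Adj (KminusHam N σ) x y → Adj (KminusHam N τ) (Inverse.to h x) (Inverse.to h y)
  preserve x y (x≢y , ¬xy , ¬yx) =
    x≢y ∘ h-injective , ¬xy ∘ Equivalence.from (follows-h x y) , ¬yx ∘ Equivalence.from (follows-h y x)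
  reflect : ∀ x y → Adj (KminusHam N τ) (Inverse.to h x) (Inverse.to h y) → Adj (KminusHam N σ) x y
  reflect x y (hx≢hy , ¬xy , ¬yx) =
    hx≢hy ∘ cong (Inverse.to h) , ¬xy ∘ Equivalence.to (follows-h x y) , ¬yx ∘ Equivalence.to (follows-h y x)

complement-cycle⇒≅KminusHam : ∀ {n} (G : Graph n) (σ : Fin n ↔ Fin n) →
  (∀ x y → Adj (complement G) x y ⇔ (Follows σ x y ⊎ Follows σ y x)) → G ≅ KminusHam n σ
complement-cycle⇒≅KminusHam G σ nonAdj⇔cycle = ↔-refl , λ x y → mk⇔ (to x y) (from x y)
  where
  to : ∀ x y → Adj G x y → x ≢ y × ¬ Follows σ x y × ¬ Follows σ y x
  to x y xy = (λ { refl → adj-irrefl G x xy }) ,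
              (λ f → proj₂ (Equivalence.from (nonAdj⇔cycle x y) (inj₁ f)) xy) ,
              (λ f → proj₂ (Equivalence.from (nonAdj⇔cycle x y) (inj₂ f)) xy)
  from : ∀ x y → x ≢ y × ¬ Follows σ x y × ¬ Follows σ y x → Adj G x y
  from x y (x≢y , ¬xy , ¬yx) with adj? G x y
  ... | yes xy = xy
  ... | no ¬adj with Equivalence.to (nonAdj⇔cycle x y) (x≢y , ¬adj)
  ...   | inj₁ f = ⊥-elim (¬xy f)
  ...   | inj₂ f = ⊥-elim (¬yx f)

-- The non-backtracking walk in a 2-regular graph

module Cycle {n : ℕ} (H : Graph n) (2-regular : ∀ x → degree H x ≡ 2) (x₀ : Fin n) where

  neighbours-pair : ∀ {x p q y} → Adj H x p → Adj H x q → p ≢ q → Adj H x y → y ≡ p ⊎ y ≡ q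
  neighbours-pair {x} xp xq p≢q xy =
    count≡2⇒pair (adjᵇ H x) (2-regular x) p≢q (adjᵇ-true⁺ H xp) (adjᵇ-true⁺ H xq) _ (adjᵇ-true⁺ H xy)

  opaque
    another-neighbour : ∀ x p → ∃ λ y → Adj H x y × y ≢ p
    another-neighbour x p =
      let y , e = count>0⇒∃ (λ y → adjᵇ H x y ∧ not (y ≡ᵇ p)) rest>0
          xy , y≢p = ∧-true⁻ {adjᵇ H x y} e
      in y , adjᵇ-true⁻ H xy , ≡ᵇ-false⇒≢ (not-true⁻ y≢p)
      where
      atP≤1 : count (λ y → adjᵇ H x y ∧ y ≡ᵇ p) ≤ 1
      atP≤1 = ℕP.≤-trans (count-mono {p = λ y → adjᵇ H x y ∧ y ≡ᵇ p}
                                     (λ y e → proj₂ (∧-true⁻ {adjᵇ H x y} e)))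
                         (ℕP.≤-reflexive (count-singleton p))
      rest>0 : 0 < count (λ y → adjᵇ H x y ∧ not (y ≡ᵇ p))
      rest>0 = ℕP.+-cancelˡ-< (count (λ y → adjᵇ H x y ∧ y ≡ᵇ p)) _ _ (begin-strict
        count (λ y → adjᵇ H x y ∧ y ≡ᵇ p) + 0 ≡⟨ ℕP.+-identityʳ _ ⟩
        count (λ y → adjᵇ H x y ∧ y ≡ᵇ p)     <⟨ s≤s atP≤1 ⟩
        2                                      ≡⟨ trans (sym (2-regular x)) (count-split (adjᵇ H x) (_≡ᵇ p)) ⟩
        count (λ y → adjᵇ H x y ∧ y ≡ᵇ p) + count (λ y → adjᵇ H x y ∧ not (y ≡ᵇ p)) ∎)
        where open ℕP.≤-Reasoning

  next : Fin n → Fin n → Fin n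
  next x p = proj₁ (another-neighbour x p)

  walk : ℕ → Fin n × Fin n
  walk zero    = x₀ , next x₀ x₀
  walk (suc k) = proj₂ (walk k) , next (proj₂ (walk k)) (proj₁ (walk k))

  w : ℕ → Fin n
  w k = proj₁ (walk k)

  w-suc : ∀ k → ∃ λ p → w (suc k) ≡ next (w k) p
  w-suc zero    = x₀ , refl
  w-suc (suc k) = w k , refl

  w-adj : ∀ k → Adj H (w k) (w (suc k))
  w-adj k = let p , e = w-suc k in subst (Adj H (w k)) (sym e) (proj₁ (proj₂ (another-neighbour (w k) p)))

  w-nonBacktracking : ∀ k → w (suc (suc k)) ≢ w k
  w-nonBacktracking k = proj₂ (proj₂ (another-neighbour (w (suc k)) (w k)))

  w-suc-≢ : ∀ k → w (suc k) ≢ w k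
  w-suc-≢ k e = adj-irrefl H (w k) (subst (Adj H (w k)) e (w-adj k))

  Repeats : ℕ → Set
  Repeats j = image j w (w j) ≡ true

  opaque
    firstRepeat : ∃ λ m → Repeats m × (∀ {j} → j < m → ¬ Repeats j)
    firstRepeat =
      let i , j , i<j , wi≡wj = FP.pigeonhole (ℕP.n<1+n n) (w ∘ toℕ)
      in least (λ j → image j w (w j) BP.≟ true) {toℕ j}
               (subst (λ z → image (toℕ j) w z ≡ true) wi≡wj (image⁺ (toℕ j) w i<j))

  m : ℕ
  m = proj₁ firstRepeat

  minimal : ∀ {a j} → j < m → a < j → w a ≢ w j
  minimal {a} {j} j<m a<j wa≡wj =
    proj₂ (proj₂ firstRepeat) j<m (subst (λ z → image j w z ≡ true) wa≡wj (image⁺ j w a<j))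

  w-injective : ∀ {a b} → a < m → b < m → w a ≡ w b → a ≡ b
  w-injective {a} {b} a<m b<m wa≡wb with ℕP.<-cmp a b
  ... | tri≈ _ a≡b _ = a≡b
  ... | tri< a<b _ _ = ⊥-elim (minimal b<m a<b wa≡wb)
  ... | tri> _ _ b<a = ⊥-elim (minimal a<m b<a (sym wa≡wb))

  -- w k is a neighbour of w (suc k) = w (suc i), hence equal to w i or w (suc (suc i)); either way the
  -- walk repeats before step suc k or steps back.
  no-inner-return : ∀ {i k} → i < k → suc k ≤ m → w (suc k) ≢ w (suc i)
  no-inner-return {i} {k} i<k 1+k≤m e
    with neighbours-pair (adj-sym H (w-adj i)) (w-adj (suc i)) (w-nonBacktracking i ∘ sym)
                         (subst (λ z → Adj H z (w k)) e (adj-sym H (w-adj k)))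
  ... | inj₁ wk≡wi = minimal 1+k≤m i<k (sym wk≡wi)
  ... | inj₂ wk≡wi+2 with ℕP.<-cmp (suc (suc i)) k
  ...   | tri< i+2<k _ _ = minimal 1+k≤m i+2<k (sym wk≡wi+2)
  ...   | tri≈ _ refl _  = w-nonBacktracking (suc i) e
  ...   | tri> _ _ k<i+2 with ℕP.≤-antisym (ℕP.≤-pred k<i+2) i<k
  ...     | refl = w-suc-≢ k e

  returns-to-start : ∀ {i k} → i < k → k ≤ m → w k ≡ w i → w k ≡ w 0
  returns-to-start {zero}           _   _   e = e
  returns-to-start {suc i} {suc k} i<k k≤m e = ⊥-elim (no-inner-return (ℕP.≤-pred i<k) k≤m e)

  first-return : 0 < m × w m ≡ w 0
  first-return = let i , i<m , wm≡wi = image⁻ m w (proj₁ (proj₂ firstRepeat))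
                 in ℕP.≤-<-trans z≤n i<m , returns-to-start i<m ℕP.≤-refl wm≡wi

  w-m : w m ≡ w 0
  w-m = proj₂ first-return

  3≤m : 3 ≤ m
  3≤m = closed-walk-length m (proj₁ first-return) w-m
    where
    closed-walk-length : ∀ k → 0 < k → w k ≡ w 0 → 3 ≤ k
    closed-walk-length 1             _ e = ⊥-elim (w-suc-≢ 0 e)
    closed-walk-length 2             _ e = ⊥-elim (w-nonBacktracking 0 e)
    closed-walk-length (suc (suc (suc k))) _ _ = s≤s (s≤s (s≤s z≤n))

  neighbours-on-cycle : ∀ {k y} → k < m → Adj H (w k) y →
                        y ≡ w (suc k) ⊎ ∃ λ p → p < m × y ≡ w p × w (suc p) ≡ w k
  neighbours-on-cycle {suc k} k<m adj
    with neighbours-pair (w-adj (suc k)) (adj-sym H (w-adj k)) (w-nonBacktracking k) adj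
  ... | inj₁ y≡wk+2 = inj₁ y≡wk+2
  ... | inj₂ y≡wk   = inj₂ (k , ℕP.<-trans (ℕP.n<1+n k) k<m , y≡wk , refl)
  neighbours-on-cycle {zero} {y} _ adj = viaLast m refl 3≤m
    where
    viaLast : ∀ k → k ≡ m → 3 ≤ k → y ≡ w 1 ⊎ ∃ λ p → p < m × y ≡ w p × w (suc p) ≡ w 0
    viaLast (suc ℓ) e (s≤s 2≤ℓ) with neighbours-pair (w-adj 0) ℓ-adj w1≢wℓ adj
      where
      ℓ<m : ℓ < m
      ℓ<m = subst (ℓ <_) e (ℕP.n<1+n ℓ)
      ℓ-adj : Adj H (w 0) (w ℓ)
      ℓ-adj = subst (λ z → Adj H z (w ℓ)) (trans (cong w e) w-m) (adj-sym H (w-adj ℓ))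
      w1≢wℓ : w 1 ≢ w ℓ
      w1≢wℓ e₁ with w-injective (ℕP.<-trans 2≤ℓ ℓ<m) ℓ<m e₁
      ... | refl = ℕP.<-irrefl refl 2≤ℓ
    ... | inj₁ y≡w1 = inj₁ y≡w1
    ... | inj₂ y≡wℓ = inj₂ (ℓ , subst (ℓ <_) e (ℕP.n<1+n ℓ) , y≡wℓ , trans (cong w e) w-m)

  onCycle : Fin n → Bool
  onCycle = image m w

  onCycle-closed : ∀ {x y} → onCycle x ≡ true → Adj H x y → onCycle y ≡ true
  onCycle-closed x∈ adj with image⁻ m w x∈
  ... | k , k<m , refl with neighbours-on-cycle k<m adj
  ...   | inj₂ (p , p<m , refl , _) = image⁺ m w p<m
  ...   | inj₁ refl with ℕP.m≤n⇒m<n∨m≡n k<m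
  ...     | inj₁ k+1<m = image⁺ m w k+1<m
  ...     | inj₂ k+1≡m = subst (λ z → image m w z ≡ true) (sym (trans (cong w k+1≡m) w-m))
                               (image⁺ m w (proj₁ first-return))

  module Hamiltonian (m≡n : m ≡ n) where

    <n⇒<m : ∀ {k} → k < n → k < m
    <n⇒<m {k} = subst (k <_) (sym m≡n)

    opaque
      w-surjective : ∀ x → ∃ λ k → k < n × w k ≡ x
      w-surjective x =
        let k , k<n , x≡wk = image⁻ n w (count-⊆-antisym {p = image n w} {q = λ _ → true} (λ _ _ → refl)
                               (ℕP.≤-reflexive (trans count-true (sym (count-image n w injective)))) x refl)
        in k , k<n , sym x≡wk
        where
        injective : ∀ {a b} → a < n → b < n → w a ≡ w b → a ≡ b
        injective a<n b<n = w-injective (<n⇒<m a<n) (<n⇒<m b<n)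

      σ : Fin n ↔ Fin n
      σ = mk↔ₛ′ (w ∘ toℕ) (λ x → F.fromℕ< (proj₁ (proj₂ (w-surjective x)))) w-from from-w
        where
        w-from : ∀ x → w (toℕ (F.fromℕ< (proj₁ (proj₂ (w-surjective x))))) ≡ x
        w-from x = let _ , k<n , wk≡x = w-surjective x in trans (cong w (FP.toℕ-fromℕ< k<n)) wk≡x
        from-w : ∀ i → F.fromℕ< (proj₁ (proj₂ (w-surjective (w (toℕ i))))) ≡ i
        from-w i = let k , k<n , wk≡wi = w-surjective (w (toℕ i)) in
          FP.toℕ-injective (trans (FP.toℕ-fromℕ< k<n) (w-injective (<n⇒<m k<n) (<n⇒<m (FP.toℕ<n i)) wk≡wi))

      σ-to : ∀ i → Inverse.to σ i ≡ w (toℕ i)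
      σ-to i = refl

    position : Fin n → ℕ
    position x = toℕ (Inverse.from σ x)

    w-position : ∀ x → w (position x) ≡ x
    w-position x = trans (sym (σ-to _)) (Inverse.strictlyInverseˡ σ x)

    position-w : ∀ {k} → k < n → position (w k) ≡ k
    position-w k<n = w-injective (<n⇒<m (FP.toℕ<n _)) (<n⇒<m k<n) (w-position _)

    follows⇒ : ∀ x y → Follows σ x y → y ≡ w (suc (position x))
    follows⇒ x y (inj₁ e) = trans (sym (w-position y)) (cong w e)
    follows⇒ x y (inj₂ (e₁ , e₂)) =
      trans (sym (w-position y)) (trans (cong w e₂) (sym (trans (cong w (trans e₁ (sym m≡n))) w-m)))

    follows⇐ : ∀ x y → y ≡ w (suc (position x)) → Follows σ x y
    follows⇐ x y refl with ℕP.m≤n⇒m<n∨m≡n (FP.toℕ<n (Inverse.from σ x))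
    ... | inj₁ 1+p<n = inj₁ (position-w 1+p<n)
    ... | inj₂ 1+p≡n = inj₂ (1+p≡n , trans (cong position (trans (cong w (trans 1+p≡n (sym m≡n))) w-m))
                                            (position-w (subst (0 <_) m≡n (proj₁ first-return))))

    adj⇔follows : ∀ x y → Adj H x y ⇔ (Follows σ x y ⊎ Follows σ y x)
    adj⇔follows x y = mk⇔ to from
      where
      to : Adj H x y → Follows σ x y ⊎ Follows σ y x
      to adj with neighbours-on-cycle (<n⇒<m (FP.toℕ<n (Inverse.from σ x)))
                                      (subst (λ z → Adj H z y) (sym (w-position x)) adj)
      ... | inj₁ y≡next = inj₁ (follows⇐ x y y≡next)
      ... | inj₂ (p , p<m , y≡wp , wp+1≡x) =
        inj₂ (follows⇐ y x (trans (sym (trans wp+1≡x (w-position x))) (cong (w ∘ suc) (sym position-y))))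
        where
        position-y : position y ≡ p
        position-y = trans (cong position y≡wp) (position-w (subst (p <_) m≡n p<m))
      adjacent-next : ∀ x y → Follows σ x y → Adj H x y
      adjacent-next x y f = subst₂ (Adj H) (w-position x) (sym (follows⇒ x y f)) (w-adj (position x))
      from : Follows σ x y ⊎ Follows σ y x → Adj H x y
      from (inj₁ f) = adjacent-next x y f
      from (inj₂ f) = adj-sym H (adjacent-next y x f)

-- Graphs consisting of two v-cliques

other : Fin 2 → Fin 2
other 0F = 1F
other 1F = 0F

≢⇒≡other : ∀ {a b : Fin 2} → a ≢ b → a ≡ other b
≢⇒≡other {0F} {0F} a≢b = ⊥-elim (a≢b refl)
≢⇒≡other {0F} {1F} _   = refl
≢⇒≡other {1F} {0F} _   = refl
≢⇒≡other {1F} {1F} a≢b = ⊥-elim (a≢b refl)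

lookup-block : ∀ {N n} (c : Fin N → Fin n) i y → lookup (block c i) y ≡ (c y ≡ᵇ i)
lookup-block c i = VP.lookup∘tabulate (λ y → c y ≡ᵇ i)

module TwoCliques {v : ℕ} (G : Graph (2 * v)) (c : Fin (2 * v) → Fin 2)
                  (cliques : ∀ i → IsClique G v (block c i)) where

  IsCliqueᵇ : (Fin (2 * v) → Bool) → Set
  IsCliqueᵇ K = count K ≡ v × (∀ y z → K y ≡ true → K z ≡ true → y ≢ z → Adj G y z)

  block-size : ∀ i → count (λ y → c y ≡ᵇ i) ≡ v
  block-size i = trans (sym (∣tabulate∣≡count (λ y → c y ≡ᵇ i))) (proj₁ (cliques i))

  otherBlock-size : ∀ i → count (λ y → not (c y ≡ᵇ i)) ≡ v
  otherBlock-size i = ℕP.+-cancelˡ-≡ v _ _ (begin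
    v + count (λ y → not (c y ≡ᵇ i))
      ≡⟨ cong (_+ count (λ y → not (c y ≡ᵇ i))) (sym (block-size i)) ⟩
    count (λ y → c y ≡ᵇ i) + count (λ y → not (c y ≡ᵇ i)) ≡⟨ count-+-count-not _ ⟩
    2 * v                                                 ≡⟨ cong (v +_) (ℕP.+-identityʳ v) ⟩
    v + v                                                 ∎)
    where open ≡-Reasoning

  sameBlock⇒adj : ∀ {x y} → c x ≡ c y → x ≢ y → Adj G x y
  sameBlock⇒adj {x} {y} cx≡cy =
    proj₂ (cliques (c x)) x y (∈tabulate⁺ _ (≡ᵇ-refl (c x))) (∈tabulate⁺ _ (≡⇒≡ᵇ (sym cx≡cy)))

  nonAdj⇒otherBlock : ∀ {x y} → Adj (complement G) x y → c x ≢ c y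
  nonAdj⇒otherBlock (x≢y , ¬xy) cx≡cy = ¬xy (sameBlock⇒adj cx≡cy x≢y)

  stronglyCP : (∀ S → IsClique G v S → ∃ λ i → S ≡ block c i) → StronglyCP 2 v G
  stronglyCP strong = c , cliques , unique , strong
    where
    unique : ∀ c′ → (∀ i → IsClique G v (block c′ i)) → ∀ x y → (c x ≡ c y) ⇔ (c′ x ≡ c′ y)
    unique c′ cliques′ x y = mk⇔ (λ cx≡cy → sym (≡ᵇ⇒≡ (c′-respects cx≡cy))) (λ c′x≡c′y → begin
        c x            ≡⟨ blockOf-c′ x ⟩
        f (c′ x)       ≡⟨ cong f c′x≡c′y ⟩
        f (c′ y)       ≡⟨ blockOf-c′ y ⟨
        c y            ∎)
      where
      open ≡-Reasoning
      f : Fin 2 → Fin 2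
      f i = proj₁ (strong (block c′ i) (cliques′ i))
      lookup-c′ : ∀ i z → lookup (block c′ i) z ≡ (c z ≡ᵇ f i)
      lookup-c′ i z =
        trans (cong (λ S → lookup S z) (proj₂ (strong (block c′ i) (cliques′ i)))) (lookup-block c (f i) z)
      blockOf-c′ : ∀ z → c z ≡ f (c′ z)
      blockOf-c′ z =
        ≡ᵇ⇒≡ (trans (sym (lookup-c′ (c′ z) z)) (trans (lookup-block c′ (c′ z) z) (≡ᵇ-refl (c′ z))))
      c′-respects : c x ≡ c y → (c′ y ≡ᵇ c′ x) ≡ true
      c′-respects cx≡cy = trans (sym (lookup-block c′ (c′ x) y))
                                (trans (lookup-c′ (c′ x) y) (≡⇒≡ᵇ (trans (sym cx≡cy) (blockOf-c′ x))))

  otherBlock-unique : ∀ {x y z} → c y ≢ c x → c z ≢ c x → c y ≡ c z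
  otherBlock-unique cy≢cx cz≢cx = trans (≢⇒≡other cy≢cx) (sym (≢⇒≡other cz≢cx))

  star : Fin (2 * v) → Fin (2 * v) → Fin (2 * v) → Bool
  star x b y = y ≡ᵇ x ∨ (not (c y ≡ᵇ c x) ∧ not (y ≡ᵇ b))

  star-centre : ∀ x b → star x b x ≡ true
  star-centre x b = cong (_∨ (not (c x ≡ᵇ c x) ∧ not (x ≡ᵇ b))) (≡ᵇ-refl x)

  star-member : ∀ {x b} y → star x b y ≡ true → y ≡ x ⊎ (c y ≢ c x × y ≢ b)
  star-member {x} y e with ∨-true⁻ {y ≡ᵇ x} e
  ... | inj₁ y≡x = inj₁ (≡ᵇ⇒≡ y≡x)
  ... | inj₂ Ry  = let cy , yb = ∧-true⁻ {not (c y ≡ᵇ c x)} Ry in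
                   inj₂ (≡ᵇ-false⇒≢ (not-true⁻ cy) , ≡ᵇ-false⇒≢ (not-true⁻ yb))

  star-clique : ∀ x b → c b ≢ c x → (∀ y → Adj (complement G) x y → y ≡ b) → IsCliqueᵇ (star x b)
  star-clique x b cb≢cx onlyB = size , adjacent
    where
    R : Fin (2 * v) → Bool
    R y = not (c y ≡ᵇ c x) ∧ not (y ≡ᵇ b)
    size : count (star x b) ≡ v
    size = begin
      count (star x b)
        ≡⟨ count-insert R (cong (λ t → not t ∧ not (x ≡ᵇ b)) (≡ᵇ-refl (c x))) ⟩
      suc (count R)
        ≡⟨ ℕP.+-comm 1 (count R) ⟩
      count R + 1
        ≡⟨ count-remove (λ y → not (c y ≡ᵇ c x)) (not-false⁺ (≢⇒≡ᵇ-false cb≢cx)) ⟩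
      count (λ y → not (c y ≡ᵇ c x))
        ≡⟨ otherBlock-size (c x) ⟩
      v ∎
      where open ≡-Reasoning
    adjacentToX : ∀ z → c z ≢ c x → z ≢ b → Adj G x z
    adjacentToX z cz≢cx z≢b with adj? G x z
    ... | yes xz  = xz
    ... | no ¬xz = ⊥-elim (z≢b (onlyB z ((λ x≡z → cz≢cx (cong c (sym x≡z))) , ¬xz)))
    adjacent : ∀ y z → star x b y ≡ true → star x b z ≡ true → y ≢ z → Adj G y z
    adjacent y z Ky Kz y≢z with star-member y Ky | star-member z Kz
    ... | inj₁ refl | inj₁ refl = ⊥-elim (y≢z refl)
    ... | inj₁ refl | inj₂ (cz≢cx , z≢b) = adjacentToX z cz≢cx z≢b
    ... | inj₂ (cy≢cx , y≢b) | inj₁ refl = adj-sym G (adjacentToX y cy≢cx y≢b)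
    ... | inj₂ (cy≢cx , _) | inj₂ (cz≢cx , _) = sameBlock⇒adj (otherBlock-unique cy≢cx cz≢cx) y≢z

  module Strong (strong : ∀ S → IsClique G v S → ∃ λ i → S ≡ block c i) where

    clique-inside-block : ∀ {K} → IsCliqueᵇ K → ∀ {x y} → K x ≡ true → K y ≡ true → c x ≡ c y
    clique-inside-block {K} (size , adjacent) {x} {y} Kx Ky = trans (inBlock x Kx) (sym (inBlock y Ky))
      where
      isBlock : ∃ λ i → tabulate K ≡ block c i
      isBlock = strong (tabulate K) (trans (∣tabulate∣≡count K) size ,
                                     λ y z y∈K z∈K → adjacent y z (∈tabulate⁻ K y∈K) (∈tabulate⁻ K z∈K))
      inBlock : ∀ z → K z ≡ true → c z ≡ proj₁ isBlock
      inBlock z Kz = ≡ᵇ⇒≡ (begin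
        c z ≡ᵇ proj₁ isBlock               ≡⟨ lookup-block c (proj₁ isBlock) z ⟨
        lookup (block c (proj₁ isBlock)) z ≡⟨ cong (λ S → lookup S z) (proj₂ isBlock) ⟨
        lookup (tabulate K) z              ≡⟨ VP.lookup∘tabulate K z ⟩
        K z                                ≡⟨ Kz ⟩
        true                               ∎)
        where open ≡-Reasoning

    nonNeighbours-avoid : 0 < v → ∀ x → degree (complement G) x ≤ 1 →
                          ∃ λ b → c b ≢ c x × (∀ y → Adj (complement G) x y → y ≡ b)
    nonNeighbours-avoid 0<v x deg≤1 with 0 ℕ.<? degree (complement G) x
    ... | yes deg>0 =
      let b , xb = count>0⇒∃ (adjᵇ (complement G) x) deg>0
          x≁b = adjᵇ-true⁻ (complement G) xb
      in b , nonAdj⇒otherBlock x≁b ∘ sym ,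
         λ y x≁y → count≤1⇒unique (adjᵇ (complement G) x) deg≤1 (adjᵇ-true⁺ (complement G) x≁y) xb
    ... | no deg≯0 =
      let b , ob = count>0⇒∃ (λ y → not (c y ≡ᵇ c x)) (subst (0 <_) (sym (otherBlock-size (c x))) 0<v)
      in b , ≡ᵇ-false⇒≢ (not-true⁻ ob) ,
         λ y x≁y → ⊥-elim (true≢false (adjᵇ-true⁺ (complement G) x≁y)
                     (count≡0⇒false _ (ℕP.n≤0⇒n≡0 (ℕP.≮⇒≥ deg≯0)) y))

    -- Otherwise star x b, with b the only possible non-neighbour of x, is a v-clique meeting both blocks.
    degree-complement≥2 : 2 ≤ v → ∀ x → 2 ≤ degree (complement G) x
    degree-complement≥2 2≤v x with 2 ℕ.≤? degree (complement G) x
    ... | yes 2≤deg = 2≤deg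
    ... | no 2≰deg  with nonNeighbours-avoid (ℕP.<-trans (s≤s z≤n) 2≤v) x (ℕP.≤-pred (ℕP.≰⇒> 2≰deg))
    ...   | b , cb≢cx , onlyB = ⊥-elim (contradiction (star-member y (proj₁ (∧-true⁻ {star x b y} Ky∖x))))
      where
      K = star-clique x b cb≢cx onlyB
      rest>0 : 0 < count (λ y → star x b y ∧ not (y ≡ᵇ x))
      rest>0 = ℕP.+-cancelʳ-< 1 0 _ (ℕP.<-≤-trans 2≤v (ℕP.≤-reflexive (sym
                 (trans (count-remove (star x b) (star-centre x b)) (proj₁ K)))))
      witness = count>0⇒∃ (λ y → star x b y ∧ not (y ≡ᵇ x)) rest>0
      y = proj₁ witness
      Ky∖x : star x b y ∧ not (y ≡ᵇ x) ≡ true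
      Ky∖x = proj₂ witness
      contradiction : y ≡ x ⊎ (c y ≢ c x × y ≢ b) → ⊥
      contradiction (inj₁ y≡x) = ≡ᵇ-false⇒≢ (not-true⁻ (proj₂ (∧-true⁻ {star x b y} Ky∖x))) y≡x
      contradiction (inj₂ (cy≢cx , _)) =
        cy≢cx (clique-inside-block K (proj₁ (∧-true⁻ {star x b y} Ky∖x)) (star-centre x b))

    module SpanningCycle (2-regular : ∀ x → degree (complement G) x ≡ 2) (x₀ : Fin (2 * v)) where

      open Cycle (complement G) 2-regular x₀ public

      A B R K : Fin (2 * v) → Bool
      A y = onCycle y ∧ (c y ≡ᵇ c x₀)
      B y = onCycle y ∧ not (c y ≡ᵇ c x₀)
      R y = not (c y ≡ᵇ c x₀) ∧ not (onCycle y)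
      K y = A y ∨ R y

      A→B : ∀ {y z} → A y ≡ true → Adj (complement G) y z → B z ≡ true
      A→B {y} {z} Ay yz = let y∈ , cy≡c₀ = ∧-true⁻ {onCycle y} Ay in
        cong₂ _∧_ (onCycle-closed y∈ yz)
                  (not-false⁺ (≢⇒≡ᵇ-false λ cz≡c₀ →
                     nonAdj⇒otherBlock yz (trans (≡ᵇ⇒≡ cy≡c₀) (sym cz≡c₀))))

      B→A : ∀ {y z} → B y ≡ true → Adj (complement G) y z → A z ≡ true
      B→A {y} {z} By yz = let y∈ , cy≢c₀ = ∧-true⁻ {onCycle y} By in
        cong₂ _∧_ (onCycle-closed y∈ yz)
                  (≡⇒≡ᵇ (otherBlock-unique (nonAdj⇒otherBlock yz ∘ sym)
                                           (≡ᵇ-false⇒≢ (not-true⁻ cy≢c₀) ∘ sym)))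

      balanced : count A ≡ count B
      balanced = regular-balanced (complement G) 2-regular A B A→B B→A

      B+R : count B + count R ≡ v
      B+R = begin
        count B + count R
          ≡⟨ cong (_+ count R) (count-cong (λ y → BP.∧-comm (onCycle y) _)) ⟩
        count (λ y → not (c y ≡ᵇ c x₀) ∧ onCycle y) + count R
          ≡⟨ count-split (λ y → not (c y ≡ᵇ c x₀)) onCycle ⟨
        count (λ y → not (c y ≡ᵇ c x₀))                         ≡⟨ otherBlock-size (c x₀) ⟩
        v                                                       ∎
        where open ≡-Reasoning

      K-size : count K ≡ v
      K-size = trans (count-∨ A R disjoint)
                     (trans (cong (_+ count R) balanced) B+R)
        where
        disjoint : ∀ y → A y ∧ R y ≡ false
        disjoint y with c y ≡ᵇ c x₀
        ... | true  = BP.∧-zeroʳ (onCycle y ∧ true)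
        ... | false = cong (_∧ not (onCycle y)) (BP.∧-zeroʳ (onCycle y))

      K-member : ∀ y → K y ≡ true →
                 (onCycle y ≡ true × c y ≡ c x₀) ⊎ (c y ≢ c x₀ × onCycle y ≡ false)
      K-member y Ky with ∨-true⁻ {A y} Ky
      ... | inj₁ Ay = let y∈ , cy = ∧-true⁻ {onCycle y} Ay in inj₁ (y∈ , ≡ᵇ⇒≡ cy)
      ... | inj₂ Ry = let cy , y∉ = ∧-true⁻ {not (c y ≡ᵇ c x₀)} Ry in
                      inj₂ (≡ᵇ-false⇒≢ (not-true⁻ cy) , not-true⁻ y∉)

      cross-adjacent : ∀ {y z} → onCycle y ≡ true → c y ≡ c x₀ →
                       c z ≢ c x₀ → onCycle z ≡ false → Adj G y z
      cross-adjacent {y} {z} y∈ cy cz z∉ with adj? G y z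
      ... | yes yz = yz
      ... | no ¬yz =
        ⊥-elim (true≢false (onCycle-closed y∈ ((λ y≡z → cz (trans (cong c (sym y≡z)) cy)) , ¬yz)) z∉)

      K-clique : IsCliqueᵇ K
      K-clique = K-size , adjacent
        where
        adjacent : ∀ y z → K y ≡ true → K z ≡ true → y ≢ z → Adj G y z
        adjacent y z Ky Kz y≢z with K-member y Ky | K-member z Kz
        ... | inj₁ (_ , cy) | inj₁ (_ , cz) = sameBlock⇒adj (trans cy (sym cz)) y≢z
        ... | inj₂ (cy , _) | inj₂ (cz , _) = sameBlock⇒adj (otherBlock-unique cy cz) y≢z
        ... | inj₁ (y∈ , cy) | inj₂ (cz , z∉) = cross-adjacent y∈ cy cz z∉
        ... | inj₂ (cy , y∉) | inj₁ (z∈ , cz) = adj-sym G (cross-adjacent z∈ cz cy y∉)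

      x₀∈K : K x₀ ≡ true
      x₀∈K = trans (cong (λ b → b ∧ (c x₀ ≡ᵇ c x₀) ∨ R x₀) (image⁺ m w (proj₁ first-return)))
                   (cong (_∨ R x₀) (≡ᵇ-refl (c x₀)))

      -- The clique K contains x₀, so strongness puts all of K into the block of x₀.
      R-empty : count R ≡ 0
      R-empty = trans (count-cong outside) (count-false {2 * v})
        where
        outside : ∀ z → R z ≡ false
        outside z with R z in Rz
        ... | false = refl
        ... | true  = ⊥-elim (≡ᵇ-false⇒≢ (not-true⁻ (proj₁ (∧-true⁻ {not (c z ≡ᵇ c x₀)} Rz)))
                               (sym (clique-inside-block K-clique x₀∈K z∈K)))
          where
          z∈K : K z ≡ true
          z∈K = trans (cong (A z ∨_) Rz) (BP.∨-zeroʳ (A z))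

      spanning : m ≡ 2 * v
      spanning = begin
        m                     ≡⟨ count-image m w w-injective ⟨
        count onCycle         ≡⟨ count-split onCycle (λ y → c y ≡ᵇ c x₀) ⟩
        count A + count B     ≡⟨ cong (_+ count B) balanced ⟩
        count B + count B     ≡⟨ cong (λ k → k + k) B≡v ⟩
        v + v                 ≡⟨ cong (v +_) (ℕP.+-identityʳ v) ⟨
        2 * v                 ∎
        where
        open ≡-Reasoning
        B≡v : count B ≡ v
        B≡v = trans (sym (ℕP.+-identityʳ (count B))) (trans (cong (count B +_) (sym R-empty)) B+R)

    complement-2-regular⇒≅KminusHam : (∀ x → degree (complement G) x ≡ 2) → Fin (2 * v) →
                                      ∃ λ σ → G ≅ KminusHam (2 * v) σ
    complement-2-regular⇒≅KminusHam 2-regular x₀ =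
      σ , complement-cycle⇒≅KminusHam G σ adj⇔follows
      where
      open SpanningCycle 2-regular x₀ using (module Hamiltonian; spanning)
      open Hamiltonian spanning using (σ; adj⇔follows)

-- Cyclic successor on Fin and the adjacency rule of Γ

sucᶜ : ∀ {n} → Fin (suc n) → Fin (suc n)
sucᶜ {n} i with n ℕ.≟ toℕ i
... | yes _   = 0F
... | no n≢i  = F.suc (F.lower₁ i n≢i)

predᶜ : ∀ {n} → Fin (suc n) → Fin (suc n)
predᶜ {n} 0F        = F.fromℕ n
predᶜ     (F.suc i) = F.inject₁ i

sucᶜ-inject₁ : ∀ {n} (i : Fin n) → sucᶜ (F.inject₁ i) ≡ F.suc i
sucᶜ-inject₁ {n} i with n ℕ.≟ toℕ (F.inject₁ i)
... | yes n≡i = ⊥-elim (ℕP.<-irrefl (sym (trans n≡i (FP.toℕ-inject₁ i))) (FP.toℕ<n i))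
... | no n≢i  = cong F.suc (FP.lower₁-inject₁′ i n≢i)

sucᶜ-fromℕ : ∀ n → sucᶜ (F.fromℕ n) ≡ 0F
sucᶜ-fromℕ n with n ℕ.≟ toℕ (F.fromℕ n)
... | yes _   = refl
... | no n≢n  = ⊥-elim (n≢n (sym (FP.toℕ-fromℕ n)))

sucᶜ-predᶜ : ∀ {n} (i : Fin (suc n)) → sucᶜ (predᶜ i) ≡ i
sucᶜ-predᶜ {n} 0F        = sucᶜ-fromℕ n
sucᶜ-predᶜ     (F.suc i) = sucᶜ-inject₁ i

predᶜ-sucᶜ : ∀ {n} (i : Fin (suc n)) → predᶜ (sucᶜ i) ≡ i
predᶜ-sucᶜ {n} i with n ℕ.≟ toℕ i
... | yes n≡i = FP.toℕ-injective (trans (FP.toℕ-fromℕ n) n≡i)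
... | no n≢i  = FP.inject₁-lower₁ i n≢i

toℕ-sucᶜ : ∀ {n} (i : Fin (suc n)) →
           toℕ (sucᶜ i) ≡ suc (toℕ i) ⊎ (toℕ (sucᶜ i) ≡ 0 × suc (toℕ i) ≡ suc n)
toℕ-sucᶜ {n} i with n ℕ.≟ toℕ i
... | yes n≡i = inj₂ (refl , cong suc (sym n≡i))
... | no n≢i  = inj₁ (cong suc (FP.toℕ-lower₁ i n≢i))

sucᶜ-≢ : ∀ {n} (i : Fin (suc (suc n))) → sucᶜ i ≢ i
sucᶜ-≢ i e with toℕ-sucᶜ i
... | inj₁ t = ℕP.1+n≢n (sym (trans (cong toℕ (sym e)) t))
... | inj₂ (t , 1+i≡2+n) = ℕP.1+n≢0 (trans (sym (ℕP.suc-injective 1+i≡2+n)) (trans (cong toℕ (sym e)) t))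

sucᶜ-closed⇒all : ∀ {n} (J : Fin (suc n) → Bool) → (∀ j → J j ≡ true → J (sucᶜ j) ≡ true) →
                  ∀ {j₀} → J j₀ ≡ true → ∀ j → J j ≡ true
sucᶜ-closed⇒all {n} J closed {j₀} Jj₀ = FI.<-weakInduction P Jzero step
  where
  P : Fin (suc n) → Set
  P j = J j ≡ true
  step : ∀ j → P (F.inject₁ j) → P (F.suc j)
  step j Jj = subst P (sucᶜ-inject₁ j) (closed _ Jj)
  Jzero : P 0F
  Jzero = subst P (sucᶜ-fromℕ n) (closed _ (FI.<-weakInduction-startingFrom P Jj₀ step (FP.≤fromℕ j₀)))

-- Divisibility of an integer z by + v unfolds to v ℕD.∣ ℤ.∣ z ∣, so Not01 is a statement about ∣ a - b ∣.
∣⊖∣≡∣-∣ : ∀ a b → ℤ.∣ a ℤ.⊖ b ∣ ≡ ∣ a - b ∣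
∣⊖∣≡∣-∣ zero    zero    = refl
∣⊖∣≡∣-∣ zero    (suc b) = refl
∣⊖∣≡∣-∣ (suc a) zero    = refl
∣⊖∣≡∣-∣ (suc a) (suc b) = trans (cong ℤ.∣_∣ (ℤP.[1+m]⊖[1+n]≡m⊖n a b)) (∣⊖∣≡∣-∣ a b)

∣a-b∣ℤ : ∀ a b → ℤ.∣ ℤ.+ a ℤ.- ℤ.+ b ∣ ≡ ∣ a - b ∣
∣a-b∣ℤ a b = trans (cong ℤ.∣_∣ (ℤP.m-n≡m⊖n a b)) (∣⊖∣≡∣-∣ a b)

∣a-b-1∣ℤ : ∀ a b → ℤ.∣ ℤ.+ a ℤ.- ℤ.+ b ℤ.- ℤ.1ℤ ∣ ≡ ∣ a - suc b ∣
∣a-b-1∣ℤ a b = trans (cong ℤ.∣_∣ a-b-1≡a-[1+b]) (∣a-b∣ℤ a (suc b))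
  where
  a-b-1≡a-[1+b] : ℤ.+ a ℤ.- ℤ.+ b ℤ.- ℤ.1ℤ ≡ ℤ.+ a ℤ.- ℤ.+ suc b
  a-b-1≡a-[1+b] = trans (ℤP.+-assoc (ℤ.+ a) (ℤ.- ℤ.+ b) (ℤ.- ℤ.1ℤ))
    (cong (ℤ._+_ (ℤ.+ a)) (trans (sym (ℤP.neg-distrib-+ (ℤ.+ b) ℤ.1ℤ))
                                 (cong (λ k → ℤ.- ℤ.+ k) (ℕP.+-comm b 1))))

multiple<⇒0 : ∀ {v d} → d < v → v ℕD.∣ d → d ≡ 0
multiple<⇒0 {d = zero}  _   _   = refl
multiple<⇒0 {d = suc d} d<v v∣d = ⊥-elim (ℕP.<-irrefl refl (ℕP.<-≤-trans d<v (ℕD.∣⇒≤ v∣d)))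

multiple-of-∣a-b∣ : ∀ {v a b} → a < v → b < v → v ℕD.∣ ∣ a - b ∣ → a ≡ b
multiple-of-∣a-b∣ {a = a} {b} a<v b<v v∣ =
  ℕP.∣m-n∣≡0⇒m≡n (multiple<⇒0 (ℕP.≤-<-trans (ℕP.∣m-n∣≤m⊔n a b) (ℕP.⊔-lub a<v b<v)) v∣)

multiple-of-∣a-1+b∣ : ∀ {v a b} → a < v → b < v → v ℕD.∣ ∣ a - suc b ∣ →
                      a ≡ suc b ⊎ (a ≡ 0 × suc b ≡ v)
multiple-of-∣a-1+b∣ {v} {a} {b} a<v b<v v∣
  with ℕP.m≤n⇒m<n∨m≡n (ℕP.≤-trans (ℕP.∣m-n∣≤m⊔n a (suc b)) (ℕP.⊔-lub (ℕP.<⇒≤ a<v) b<v))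
... | inj₁ d<v = inj₁ (ℕP.∣m-n∣≡0⇒m≡n (multiple<⇒0 d<v v∣))
... | inj₂ d≡v with ℕP.∣m-n∣≡[m∸n]∨[n∸m] a (suc b)
...   | inj₁ d≡a∸b = ⊥-elim (ℕP.<-irrefl refl (ℕP.<-≤-trans a<v
                       (ℕP.≤-trans (ℕP.≤-reflexive (trans (sym d≡v) d≡a∸b)) (ℕP.m∸n≤m a (suc b)))))
...   | inj₂ d≡b∸a with a
...     | zero   = inj₂ (refl , trans (sym d≡b∸a) d≡v)
...     | suc a′ = ⊥-elim (ℕP.<-irrefl refl (ℕP.≤-trans (s≤s v≤b) b<v))
  where
  v≤b : v ≤ b
  v≤b = ℕP.≤-trans (ℕP.≤-reflexive (trans (sym d≡v) d≡b∸a)) (ℕP.m∸n≤m b a′)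

≡sucᶜ⇔ : ∀ {n} (a b : Fin (suc n)) →
         (a ≡ sucᶜ b) ⇔ (toℕ a ≡ suc (toℕ b) ⊎ (toℕ a ≡ 0 × suc (toℕ b) ≡ suc n))
≡sucᶜ⇔ {n} a b = mk⇔ (λ { refl → toℕ-sucᶜ b }) from
  where
  a≢last : toℕ a ≢ suc n
  a≢last e = ℕP.<-irrefl e (FP.toℕ<n a)
  from : toℕ a ≡ suc (toℕ b) ⊎ (toℕ a ≡ 0 × suc (toℕ b) ≡ suc n) → a ≡ sucᶜ b
  from a-rel with a-rel | toℕ-sucᶜ b
  ... | inj₁ a≡1+b       | inj₁ s≡1+b       = FP.toℕ-injective (trans a≡1+b (sym s≡1+b))
  ... | inj₁ a≡1+b       | inj₂ (_ , 1+b≡v) = ⊥-elim (a≢last (trans a≡1+b 1+b≡v))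
  ... | inj₂ (_ , 1+b≡v) | inj₁ s≡1+b       =
    ⊥-elim (ℕP.<-irrefl (trans s≡1+b 1+b≡v) (FP.toℕ<n (sucᶜ b)))
  ... | inj₂ (a≡0 , _)   | inj₂ (s≡0 , _)   = FP.toℕ-injective (trans a≡0 (sym s≡0))

Not01⇔ : ∀ {n} (a b : Fin (suc n)) → Not01 (suc n) a b ⇔ (a ≢ b × a ≢ sucᶜ b)
Not01⇔ {n} a b = mk⇔ (λ (¬v∣d , ¬v∣d-1) → ¬v∣d ∘ diff , ¬v∣d-1 ∘ diff-1)
                     (λ (a≢b , a≢sb) → a≢b ∘ diff⁻ , a≢sb ∘ diff-1⁻)
  where
  a<v = FP.toℕ<n a
  b<v = FP.toℕ<n b
  diff : a ≡ b → ℤ.+ suc n ℤD.∣ (ℤ.+ toℕ a ℤ.- ℤ.+ toℕ b)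
  diff refl = subst (suc n ℕD.∣_) (sym (trans (∣a-b∣ℤ (toℕ a) (toℕ a)) (ℕP.∣n-n∣≡0 (toℕ a))))
                    (ℕD._∣0 (suc n))
  diff⁻ : ℤ.+ suc n ℤD.∣ (ℤ.+ toℕ a ℤ.- ℤ.+ toℕ b) → a ≡ b
  diff⁻ v∣ =
    FP.toℕ-injective (multiple-of-∣a-b∣ a<v b<v (subst (suc n ℕD.∣_) (∣a-b∣ℤ (toℕ a) (toℕ b)) v∣))
  diff-1 : a ≡ sucᶜ b → ℤ.+ suc n ℤD.∣ (ℤ.+ toℕ a ℤ.- ℤ.+ toℕ b ℤ.- ℤ.1ℤ)
  diff-1 a≡sb =
    subst (suc n ℕD.∣_) (sym (∣a-b-1∣ℤ (toℕ a) (toℕ b))) (multiple (Equivalence.to (≡sucᶜ⇔ a b) a≡sb))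
    where
    multiple : toℕ a ≡ suc (toℕ b) ⊎ (toℕ a ≡ 0 × suc (toℕ b) ≡ suc n) →
               suc n ℕD.∣ ∣ toℕ a - suc (toℕ b) ∣
    multiple (inj₁ e)         = subst (λ k → suc n ℕD.∣ ∣ k - suc (toℕ b) ∣) (sym e)
                                      (subst (suc n ℕD.∣_) (sym (ℕP.∣n-n∣≡0 (suc (toℕ b))))
                                             (ℕD._∣0 (suc n)))
    multiple (inj₂ (e₀ , e₁)) = subst (λ k → suc n ℕD.∣ ∣ k - suc (toℕ b) ∣) (sym e₀)
                                      (subst (suc n ℕD.∣_) (sym e₁) ℕD.∣-refl)
  diff-1⁻ : ℤ.+ suc n ℤD.∣ (ℤ.+ toℕ a ℤ.- ℤ.+ toℕ b ℤ.- ℤ.1ℤ) → a ≡ sucᶜ b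
  diff-1⁻ v∣ = Equivalence.from (≡sucᶜ⇔ a b)
                 (multiple-of-∣a-1+b∣ a<v b<v (subst (suc n ℕD.∣_) (∣a-b-1∣ℤ (toℕ a) (toℕ b)) v∣))

-- The graph Γ(2,v)

module Γ₂ (n : ℕ) where

  v : ℕ
  v = suc (suc n)

  vertex : Fin 2 → Fin v → Fin (2 * v)
  vertex = F.combine

  row : Fin (2 * v) → Fin 2
  row x = proj₁ (F.remQuot {2} v x)

  col : Fin (2 * v) → Fin v
  col x = proj₂ (F.remQuot {2} v x)

  row-vertex : ∀ i j → row (vertex i j) ≡ i
  row-vertex i j = cong proj₁ (FP.remQuot-combine i j)

  vertex-row-col : ∀ x → vertex (row x) (col x) ≡ x
  vertex-row-col = FP.combine-remQuot {2} v

  ≗-on-vertices : ∀ {A : Set} (f g : Fin (2 * v) → A) →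
                  (∀ i j → f (vertex i j) ≡ g (vertex i j)) → ∀ x → f x ≡ g x
  ≗-on-vertices f g f≗g x = subst (λ y → f y ≡ g y) (vertex-row-col x) (f≗g (row x) (col x))

  count-vertices : ∀ (p : Fin (2 * v) → Bool) → count p ≡ count (p ∘ vertex 0F) + count (p ∘ vertex 1F)
  count-vertices p = trans (∑-combine 2 {v} (indicator ∘ p))
                           (cong (count (p ∘ vertex 0F) +_) (ℕP.+-identityʳ (count (p ∘ vertex 1F))))

  Γ-adj : ∀ i j k l → Adj (Γ 2 v) (vertex i j) (vertex k l) ≡ ΓAdj' (i , j) (k , l)
  Γ-adj i j k l = cong₂ ΓAdj' (FP.remQuot-combine i j) (FP.remQuot-combine k l)

  rows-cliques : ∀ i → IsClique (Γ 2 v) v (block row i)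
  rows-cliques i = size , adjacent
    where
    rowSize : ∀ i → count {v} (λ _ → 0F ≡ᵇ i) + count {v} (λ _ → 1F ≡ᵇ i) ≡ v
    rowSize 0F = trans (cong₂ _+_ (count-true {v}) (count-false {v})) (ℕP.+-identityʳ v)
    rowSize 1F = cong₂ _+_ (count-false {v}) (count-true {v})
    size : ∣ block row i ∣ ≡ v
    size = begin
      ∣ block row i ∣                                  ≡⟨ ∣tabulate∣≡count (λ x → row x ≡ᵇ i) ⟩
      count (λ x → row x ≡ᵇ i)                         ≡⟨ count-vertices (λ x → row x ≡ᵇ i) ⟩
      count (λ j → row (vertex 0F j) ≡ᵇ i) + count (λ j → row (vertex 1F j) ≡ᵇ i)
        ≡⟨ cong₂ _+_ (count-cong (λ j → cong (_≡ᵇ i) (row-vertex 0F j)))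
                     (count-cong (λ j → cong (_≡ᵇ i) (row-vertex 1F j))) ⟩
      count {v} (λ _ → 0F ≡ᵇ i) + count {v} (λ _ → 1F ≡ᵇ i) ≡⟨ rowSize i ⟩
      v                                                ∎
      where open ≡-Reasoning
    adjacent : ∀ x y → x ∈ block row i → y ∈ block row i → x ≢ y → Adj (Γ 2 v) x y
    adjacent x y x∈ y∈ x≢y = inj₁ (rx≡ry , λ cx≡cy → x≢y (begin
      x                      ≡⟨ vertex-row-col x ⟨
      vertex (row x) (col x) ≡⟨ cong₂ vertex rx≡ry cx≡cy ⟩
      vertex (row y) (col y) ≡⟨ vertex-row-col y ⟩
      y                      ∎))
      where
      open ≡-Reasoning
      rx≡ry : row x ≡ row y
      rx≡ry = trans (≡ᵇ⇒≡ (∈tabulate⁻ (λ z → row z ≡ᵇ i) x∈))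
                    (sym (≡ᵇ⇒≡ (∈tabulate⁻ (λ z → row z ≡ᵇ i) y∈)))

  cross-adj⇔ : ∀ j l → Adj (Γ 2 v) (vertex 0F j) (vertex 1F l) ⇔ (l ≢ j × l ≢ sucᶜ j)
  cross-adj⇔ j l = mk⇔ to from
    where
    to : Adj (Γ 2 v) (vertex 0F j) (vertex 1F l) → l ≢ j × l ≢ sucᶜ j
    to adj with subst id (Γ-adj 0F j 1F l) adj
    ... | inj₂ (inj₁ (_ , not01)) = Equivalence.to (Not01⇔ l j) not01
    from : l ≢ j × l ≢ sucᶜ j → Adj (Γ 2 v) (vertex 0F j) (vertex 1F l)
    from l-ok = subst id (sym (Γ-adj 0F j 1F l))
                         (inj₂ (inj₁ (s≤s z≤n , Equivalence.from (Not01⇔ l j) l-ok)))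

  partner : Fin 2 → Fin v → Fin v
  partner 0F j = sucᶜ j
  partner 1F j = predᶜ j

  partner-≢ : ∀ i j → partner i j ≢ j
  partner-≢ 0F j     = sucᶜ-≢ j
  partner-≢ 1F j p≡j = sucᶜ-≢ (predᶜ j) (trans (sucᶜ-predᶜ j) (sym p≡j))

  nonNeighbours : ∀ i j k l → Adj (complement (Γ 2 v)) (vertex i j) (vertex k l) →
                  k ≡ other i × (l ≡ j ⊎ l ≡ partner i j)
  nonNeighbours 0F j 0F l (x≢y , ¬adj) =
    ⊥-elim (¬adj (subst id (sym (Γ-adj 0F j 0F l)) (inj₁ (refl , λ j≡l → x≢y (cong (vertex 0F) j≡l)))))
  nonNeighbours 1F j 1F l (x≢y , ¬adj) =
    ⊥-elim (¬adj (subst id (sym (Γ-adj 1F j 1F l))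
                            (inj₁ (refl , λ j≡l → x≢y (cong (vertex 1F) j≡l)))))
  nonNeighbours 0F j 1F l (_ , ¬adj) =
    refl , ¬[≢×≢]⇒≡⊎≡ (¬adj ∘ Equivalence.from (cross-adj⇔ j l))
  nonNeighbours 1F j 0F l (_ , ¬adj)
    with ¬[≢×≢]⇒≡⊎≡ (¬adj ∘ adj-sym (Γ 2 v) {vertex 0F l} {vertex 1F j}
                          ∘ Equivalence.from (cross-adj⇔ l j))
  ... | inj₁ j≡l  = refl , inj₁ (sym j≡l)
  ... | inj₂ j≡sl = refl , inj₂ (trans (sym (predᶜ-sucᶜ l)) (cong predᶜ (sym j≡sl)))

  degree-complement≤2 : ∀ x → degree (complement (Γ 2 v)) x ≤ 2
  degree-complement≤2 x =
    subst (λ z → degree (complement (Γ 2 v)) z ≤ 2) (vertex-row-col x) (bound (row x) (col x))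
    where
    bound : ∀ i j → degree (complement (Γ 2 v)) (vertex i j) ≤ 2
    bound i j = ℕP.≤-trans (count-mono ⊆pair) (ℕP.≤-reflexive (count-pair partners-distinct))
      where
      partners-distinct : vertex (other i) j ≢ vertex (other i) (partner i j)
      partners-distinct = partner-≢ i j ∘ sym ∘ FP.combine-injectiveʳ (other i) j (other i) (partner i j)
      ⊆pair : adjᵇ (complement (Γ 2 v)) (vertex i j) ⊆ᵇ
              (λ y → y ≡ᵇ vertex (other i) j ∨ y ≡ᵇ vertex (other i) (partner i j))
      ⊆pair y e with nonNeighbours i j (row y) (col y)
                       (subst (Adj (complement (Γ 2 v)) (vertex i j)) (sym (vertex-row-col y))
                              (adjᵇ-true⁻ (complement (Γ 2 v)) e))
      ... | r≡ , inj₁ c≡ = cong (_∨ (y ≡ᵇ vertex (other i) (partner i j)))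
                                (≡⇒≡ᵇ (trans (sym (vertex-row-col y)) (cong₂ vertex r≡ c≡)))
      ... | r≡ , inj₂ c≡ = trans (cong (y ≡ᵇ vertex (other i) j ∨_)
                                       (≡⇒≡ᵇ (trans (sym (vertex-row-col y)) (cong₂ vertex r≡ c≡))))
                                 (BP.∨-zeroʳ (y ≡ᵇ vertex (other i) j))

  -- (0,j) and (1,l) are adjacent iff l ∉ {j, sucᶜ j}; so in a v-clique S the part S₁ in row 1 is the
  -- complement of the part S₀ in row 0, and S₀ is closed under sucᶜ.
  rows-strong : ∀ S → IsClique (Γ 2 v) v S → ∃ λ i → S ≡ block row i
  rows-strong S (size , adjacent) = byFirstRow (0 ℕ.<? count S₀)
    where
    S₀ S₁ : Fin v → Bool
    S₀ j = lookup S (vertex 0F j)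
    S₁ l = lookup S (vertex 1F l)
    S₀+S₁ : count S₀ + count S₁ ≡ v
    S₀+S₁ = trans (sym (count-vertices (lookup S)))
                (trans (sym (∣tabulate∣≡count (lookup S))) (trans (cong ∣_∣ (VP.tabulate∘lookup S)) size))
    cross : ∀ {j l} → S₀ j ≡ true → S₁ l ≡ true → l ≢ j × l ≢ sucᶜ j
    cross {j} {l} S₀j S₁l = Equivalence.to (cross-adj⇔ j l)
      (adjacent _ _ (VP.lookup⇒[]= _ S S₀j) (VP.lookup⇒[]= _ S S₁l)
                (λ e → FP.0≢1+n (FP.combine-injectiveˡ {2} 0F j 1F l e)))
    S₁⊆∁S₀ : S₁ ⊆ᵇ (not ∘ S₀)
    S₁⊆∁S₀ l S₁l with S₀ l in S₀l
    ... | true  = ⊥-elim (proj₁ (cross S₀l S₁l) refl)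
    ... | false = refl
    ∁S₀⊆S₁ : (not ∘ S₀) ⊆ᵇ S₁
    ∁S₀⊆S₁ = count-⊆-antisym S₁⊆∁S₀ (ℕP.≤-reflexive (ℕP.+-cancelˡ-≡ (count S₀) _ _
               (trans (count-+-count-not S₀) (sym S₀+S₁))))
    S-is-row : ∀ i → (∀ k l → lookup S (vertex k l) ≡ (k ≡ᵇ i)) → S ≡ block row i
    S-is-row i onVertices = trans (sym (VP.tabulate∘lookup S))
      (VP.tabulate-cong (≗-on-vertices (lookup S) (λ x → row x ≡ᵇ i)
        (λ k l → trans (onVertices k l) (cong (_≡ᵇ i) (sym (row-vertex k l))))))
    S₀-nonempty⇒row₀ : 0 < count S₀ → S ≡ block row 0F
    S₀-nonempty⇒row₀ S₀>0 = S-is-row 0F λ where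
        0F l → trans (S₀-full l) (sym (≡ᵇ-refl {2} 0F))
        1F l → S₁-empty l
      where
      S₀-sucᶜ-closed : ∀ j → S₀ j ≡ true → S₀ (sucᶜ j) ≡ true
      S₀-sucᶜ-closed j S₀j with S₀ (sucᶜ j) in S₀sj
      ... | true  = refl
      ... | false = ⊥-elim (proj₂ (cross S₀j (∁S₀⊆S₁ (sucᶜ j) (not-false⁺ S₀sj))) refl)
      S₀-full : ∀ l → S₀ l ≡ true
      S₀-full = sucᶜ-closed⇒all S₀ S₀-sucᶜ-closed (proj₂ (count>0⇒∃ S₀ S₀>0))
      S₁-empty : ∀ l → S₁ l ≡ false
      S₁-empty l with S₁ l in S₁l
      ... | true  = ⊥-elim (true≢false (S₀-full l) (not-true⁻ (S₁⊆∁S₀ l S₁l)))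
      ... | false = refl
    S₀-empty⇒row₁ : count S₀ ≡ 0 → S ≡ block row 1F
    S₀-empty⇒row₁ S₀≡0 = S-is-row 1F λ where
        0F l → count≡0⇒false S₀ S₀≡0 l
        1F l → trans (S₁-full l) (sym (≡ᵇ-refl {2} 1F))
      where
      S₁-full : ∀ l → S₁ l ≡ true
      S₁-full l = count-⊆-antisym {p = S₁} {q = λ _ → true} (λ _ _ → refl)
                    (ℕP.≤-reflexive (trans (count-true {v}) (trans (sym S₀+S₁) (cong (_+ count S₁) S₀≡0))))
                    l refl
    byFirstRow : Dec (0 < count S₀) → ∃ λ i → S ≡ block row i
    byFirstRow (yes S₀>0) = 0F , S₀-nonempty⇒row₀ S₀>0
    byFirstRow (no S₀≯0)  = 1F , S₀-empty⇒row₁ (ℕP.n≤0⇒n≡0 (ℕP.≮⇒≥ S₀≯0))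

-- Maximal strongly (2,v)-clique-partitioned graphs

maximal-edges : ∀ k → let N = 2 * suc (suc k) in N * suc k + N * 1 * k + N * 2 + N ≡ N * N
maximal-edges = solve-∀

module Maximal (k : ℕ) where

  open Γ₂ k

  N : ℕ
  N = 2 * v

  maximal-edges⇔ : ∀ (G : Graph N) → (2 * numEdges G ≡ 2 * v * (v ∸ 1) + 2 * v * (2 ∸ 1) * (v ∸ 2)) ⇔
                                     (∑[ x < N ] degree (complement G) x ≡ N * 2)
  maximal-edges⇔ G = mk⇔
    (λ e → ℕP.+-cancelˡ-≡ T _ _ (ℕP.+-cancelʳ-≡ N _ _ (trans (cong (λ a → a + S + N) (sym e)) both-N²)))
    (λ e → ℕP.+-cancelʳ-≡ (N * 2) _ _ (ℕP.+-cancelʳ-≡ N _ _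
             (trans (cong (λ a → 2 * numEdges G + a + N) (sym e)) both-N²)))
    where
    T = N * suc k + N * 1 * k
    S = ∑[ x < N ] degree (complement G) x
    both-N² : 2 * numEdges G + S + N ≡ T + N * 2 + N
    both-N² = trans (∑-degree-+-complement G) (sym (maximal-edges k))

  2≤v : 2 ≤ v
  2≤v = s≤s (s≤s z≤n)

  maximal-≅KminusHam : ∀ G → MaximalSCP 2 v G → ∃ λ σ → G ≅ KminusHam N σ
  maximal-≅KminusHam G ((c , cliques , _ , strong) , edges) =
    complement-2-regular⇒≅KminusHam
      (∑≡2n⇒2-regular _ (degree-complement≥2 2≤v) (Equivalence.to (maximal-edges⇔ G) edges)) 0F
    where
    open TwoCliques G c cliques
    open Strong strong

  module ΓRows = TwoCliques (Γ 2 v) row rows-cliques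

  Γ-complement-2-regular : ∀ x → degree (complement (Γ 2 v)) x ≡ 2
  Γ-complement-2-regular x =
    ℕP.≤-antisym (degree-complement≤2 x) (ΓRows.Strong.degree-complement≥2 rows-strong 2≤v x)

  Γ-maximal : MaximalSCP 2 v (Γ 2 v)
  Γ-maximal = ΓRows.stronglyCP rows-strong ,
              Equivalence.from (maximal-edges⇔ (Γ 2 v))
                               (trans (sum-cong-≗ Γ-complement-2-regular) (∑-const N 2))

  Γ-≅KminusHam : ∃ λ σ → Γ 2 v ≅ KminusHam N σ
  Γ-≅KminusHam = ΓRows.Strong.complement-2-regular⇒≅KminusHam rows-strong Γ-complement-2-regular 0F

  maximal-unique : ∀ G → MaximalSCP 2 v G → G ≅ Γ 2 v
  maximal-unique G maximal =
    let σ , G≅ = maximal-≅KminusHam G maximal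
        τ , Γ≅ = Γ-≅KminusHam
    in ≅-trans {G = G} {KminusHam N σ} {Γ 2 v} G≅
         (≅-trans {G = KminusHam N σ} {KminusHam N τ} {Γ 2 v} (KminusHam-unique N σ τ)
                  (≅-sym {G = Γ 2 v} {KminusHam N τ} Γ≅))

theorem2p6 : (v : ℕ) → 2 ≤ v →
    MaximalSCP 2 v (Γ 2 v) ×
    (∀ (G : Graph (2 * v)) → MaximalSCP 2 v G → G ≅ Γ 2 v) ×
    ∃ λ (σ : Fin (2 * v) ↔ Fin (2 * v)) → Γ 2 v ≅ KminusHam (2 * v) σ
theorem2p6 0             ()
theorem2p6 1             (s≤s ())
theorem2p6 (suc (suc k)) _ = Γ-maximal , maximal-unique , Γ-≅KminusHam
  where open Maximal k
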